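{- Let $p_3$ be a positive integer with $\gcd(6,p_3)=1$, $P=6p_3$, $\bm\ell=(1,1,\ell_3)$ with $0<\ell_3<p_3$, and let $\bm\epsilon=(\epsilon_1,\epsilon_2,\epsilon_3),\bm\epsilon'=(\epsilon_1',\epsilon_2',\epsilon_3')\in\{\pm1\}^3$. Let $M,N$ be coprime positive integers and $q=e^{2\pi iM/N}$. Then: (i) If $\frac{\epsilon_1+\epsilon_1'}{2}\equiv N\pmod2$, $\epsilon_2+\epsilon_2'\equiv N\pmod3$ and $\epsilon_3'=-\epsilon_3$, then $\frac{m(\bm\epsilon)+m(\bm\epsilon')}{2P}\equiv\frac N6\pmod1$ and $T_{\bm\epsilon}=e^{\pi i(p_3N-m(\bm\epsilon'))M/3}T_{\bm\epsilon'}$. (ii) If $\frac{\epsilon_1-\epsilon_1'}{2}\equiv N\pmod2$, $\epsilon_2-\epsilon_2'\equiv N\pmod3$ and $\epsilon_3'=\epsilon_3$, then $\frac{m(\bm\epsilon)-m(\bm\epsilon')}{2P}\equiv\frac N6\pmod1$ and $S_{\bm\epsilon}=e^{\pi i(p_3N+m(\bm\epsilon'))M/3}T_{\bm\epsilon'}$. (iii) If $\frac{\epsilon_1+\epsilon_1'}{2}\equiv0\pmod2$, $\epsilon_2+\epsilon_2'\equiv2N\pmod3$ and $\epsilon_3=-\epsilon_3'$, then $\frac{m(\bm\epsilon)+m(\bm\epsilon')}{2P}\equiv\frac N3\pmod1$ and $S_{\bm\epsilon}=e^{2\pi i(2p_3N-m(\bm\epsilon'))M/3}T_{\bm\epsilon'}$.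 (iv) If $\frac{\epsilon_1+\epsilon_1'}{2}\equiv N\pmod2$, $\epsilon_2+\epsilon_2'\equiv0\pmod3$ and $\epsilon_3=-\epsilon_3'$, then $\frac{m(\bm\epsilon)+m(\bm\epsilon')}{2P}\equiv\frac N2\pmod1$ and $S_{\bm\epsilon}=e^{\pi i(p_3N-m(\bm\epsilon'))M}S_{\bm\epsilon'}$.
   Context: For $\bm\epsilon\in\{\pm1\}^3$, $m(\bm\epsilon)\in\{0,1,\dots,2P-1\}$ is defined by $m(\bm\epsilon)\equiv P\bigl(1+\frac{\epsilon_1}{2}+\frac{\epsilon_2}{3}+\frac{\epsilon_3\ell_3}{p_3}\bigr)\pmod{2P}$. Define $T_{\bm\epsilon}=\sum_{n\equiv m(\bm\epsilon)\bmod 2P,\ 0\le n\le 2p_3N}q^{n^2/(4P)}$ and $S_{\bm\epsilon}=\sum_{n\equiv m(\bm\epsilon)\bmod 2P,\ 2p_3N<n\le 4p_3N}q^{n^2/(4P)}$, where $q^x:=e^{2\pi iMx/N}$ for real $x$. -}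

module Defs where

open import Level using (Level)
open import Data.Nat as ℕ using (ℕ; zero; suc)
open import Data.Integer as ℤ using (ℤ; +_; _%ℕ_)
open import Data.Integer.Divisibility using () renaming (_∣_ to _∣ℤ_)
open import Data.Rational.Unnormalised as Q using (ℚᵘ; _≃_; _/_)
open import Data.Sign using (Sign)
open import Data.Product using (Σ; _×_; _,_)
open import Data.List using (List; filter; map; foldr; upTo)
open import Relation.Nullary.Decidable using (¬?)
open import Algebra.Bundles using (CommutativeRing; Semiring)

sgn : Sign → ℤ
sgn Sign.+ = + 1
sgn Sign.- = ℤ.- (+ 1)

Triple : Set
Triple = Sign × Sign × Sign

ε₁ ε₂ ε₃ : Triple → ℤ
ε₁ (a , _ , _) = sgn a
ε₂ (_ , b , _) = sgn b
ε₃ (_ , _ , c) = sgn c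

-- Residue of an integer modulo d, in {0,…,d-1} (for d = 0 a dummy 0;
-- only used with d > 0 under the hypotheses of the theorem).

_mod_ : ℤ → ℕ → ℕ
a mod zero  = 0
a mod suc d = a %ℕ suc d

infix 4 _≡_[mod_] _≡_[mod1]
_≡_[mod_] : ℤ → ℤ → ℕ → Set
a ≡ b [mod n ] = (+ n) ∣ℤ (a ℤ.- b)

_≡_[mod1] : ℚᵘ → ℚᵘ → Set
x ≡ y [mod1] = Σ ℤ (λ k → (x Q.- y) ≃ (k / 1))

-- P = 6 p₃ and m(ε) ∈ {0,…,2P-1} with
-- m(ε) ≡ P (1 + ε₁/2 + ε₂/3 + ε₃ ℓ₃/p₃)  (mod 2P),
-- where P(1 + ε₁/2 + ε₂/3 + ε₃ℓ₃/p₃) = 6p₃ + 3p₃ε₁ + 2p₃ε₂ + 6ℓ₃ε₃.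

P : ℕ → ℕ
P p₃ = 6 ℕ.* p₃

m : (p₃ ℓ₃ : ℕ) → Triple → ℕ
m p₃ ℓ₃ ε =
  (+ (6 ℕ.* p₃) ℤ.+ + (3 ℕ.* p₃) ℤ.* ε₁ ε ℤ.+ + (2 ℕ.* p₃) ℤ.* ε₂ ε
    ℤ.+ + (6 ℕ.* ℓ₃) ℤ.* ε₃ ε) mod (2 ℕ.* P p₃)

-- The complex number e^{2πi/K} is modelled by an
-- element ζ of a commutative ring with ζ^K = 1 that is a primitive K-th
-- root of unity.  Then e^{2πi a/K} = ζ^(a mod K) for a ∈ ℤ, and
--   q^x = e^{2πi M x / N}   for x = n²/(4P)  equals  e^{2πi M n² / K}.

Kord : (p₃ N : ℕ) → ℕ
Kord p₃ N = 4 ℕ.* P p₃ ℕ.* N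

module RootsOfUnity {c ℓ : Level} (R : CommutativeRing c ℓ)
                    (ζ : CommutativeRing.Carrier R) (K : ℕ) where
  open CommutativeRing R
  open import Algebra.Definitions.RawSemiring (Semiring.rawSemiring semiring) using (_^_)
  open import Relation.Nullary using (¬_)

  ζ^ℤ : ℤ → Carrier
  ζ^ℤ a = ζ ^ (a mod K)

  -- e^{2πi a/d} for d ∣ K  (d > 0)
  e2πi[_/_] : ℤ → (d : ℕ) → .{{ℕ.NonZero d}} → Carrier
  e2πi[ a / d ] = ζ^ℤ (a ℤ.* + (K ℕ./ d))

  IsPrimitiveRootOfUnity : Set ℓ
  IsPrimitiveRootOfUnity =
    (ζ ^ K ≈ 1#) × (∀ j → 0 ℕ.< j → j ℕ.< K → ¬ (ζ ^ j ≈ 1#))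

  ΣRange : (lo hi : ℕ) → (d r : ℕ) → (ℕ → Carrier) → Carrier
  ΣRange lo hi d r f =
    foldr _+_ 0# (map f (filter (λ n → (+ n) mod d ℕ.≟ r)
                          (filter (λ n → lo ℕ.≤? n) (upTo (suc hi)))))

module Sums {c ℓ : Level} (R : CommutativeRing c ℓ)
            (ζ : CommutativeRing.Carrier R) (p₃ ℓ₃ M N : ℕ) where
  open CommutativeRing R
  open RootsOfUnity R ζ (Kord p₃ N) public

  qpow : ℕ → Carrier
  qpow n = ζ^ℤ (+ (M ℕ.* (n ℕ.* n)))

  T : Triple → Carrier
  T ε = ΣRange 0 (2 ℕ.* p₃ ℕ.* N) (2 ℕ.* P p₃) (m p₃ ℓ₃ ε) qpow

  S : Triple → Carrier
  S ε = ΣRange (suc (2 ℕ.* p₃ ℕ.* N)) (4 ℕ.* p₃ ℕ.* N) (2 ℕ.* P p₃) (m p₃ ℓ₃ ε) qpow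

-- the rational number a/d (d > 0; dummy value 0 for d = 0, never used
-- under the hypotheses of the theorem)

_÷_ : ℤ → ℕ → ℚᵘ
a ÷ zero  = Q.0ℚᵘ
a ÷ suc d = a / suc d

-- a/2 for an integer a (exact when a is even, as in all uses below)
half : ℤ → ℤ
half a = a ℤ./ℕ 2

module Submission where

open import Defs
open import Level using (Level)
open import Data.Nat as ℕ using (ℕ)
open import Data.Nat.Coprimality using (Coprime)
open import Data.Integer as ℤ using (ℤ; +_)
open import Data.Product using (_×_)
open import Relation.Binary.PropositionalEquality using (_≡_)
open import Algebra.Bundles using (CommutativeRing)
open import Level using (0ℓ)
open import Data.Nat using (zero; suc)
open import Data.Product using (_,_; proj₁)
open import Data.Fin using (Fin; toℕ; opposite; inject₁; fromℕ)
open import Data.List using ([]; _∷_; filter; map; foldr; applyUpTo)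
open import Data.Sign using (Sign)
open import Data.Empty using (⊥-elim)
open import Relation.Nullary using (Dec; yes; no; ¬_)
open import Relation.Unary using (Decidable)
open import Relation.Binary.Bundles using (Setoid)
import Relation.Binary.PropositionalEquality as ≡
import Relation.Binary.Reasoning.Setoid as SetoidReasoning
import Data.Nat.Properties as ℕP
import Data.Nat.Divisibility as ℕD
import Data.Integer.Properties as ℤP
import Data.Integer.Divisibility.Signed as Signed

-- Write q(n) = ζ^(M n²) with ζ^K = 1, K = 4PN, so that T_ε and S_ε sum q over
-- the class m(ε) mod 2P.  Since M (2h ± n)² = M n² + 4hM (h ± n), the
-- reflection n ↦ 2h − n and the shift n ↦ 2h + n multiply q(n) by
-- ζ^(4hM (h ± n)); when K = 4hd this is e^(2πi (h ± n) M / d), which depends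
-- only on n mod d, hence (as d ∣ 2P) only on the class of n mod 2P.  The
-- congruences on ε, ε′ say exactly that m(ε) + m(ε′) ≡ 2h, resp.
-- m(ε) − m(ε′) ≡ 2h (mod 2P), for (h, d) = (p₃N, 6), (2p₃N, 3) or (3p₃N, 2);
-- so the reflection or shift carries the terms of one sum onto those of the
-- other, all multiplied by the same root of unity.  The summation windows only
-- correspond up to endpoints divisible by p₃, and those terms vanish:
-- m(ε) ≡ 6ℓ₃ε₃ (mod p₃), which p₃ does not divide as gcd(6, p₃) = 1 and
-- 0 < ℓ₃ < p₃.

module Congruence where
  open ≡ using (refl; sym; trans; cong; subst; module ≡-Reasoning)
  open import Data.Integer using (_+_; _-_; _*_; -_)
  open import Data.Integer.DivMod using (a≡a%ℕn+[a/ℕn]*n; n%ℕd<d)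
  open import Data.Integer.Tactic.RingSolver using (solve-∀)

  -- The congruence of Defs unfolds to a divisibility between absolute values,
  -- from which a, b, n cannot be recovered by unification; as a record
  -- indexed by them they can.
  infix 4 _≡_⟨mod_⟩
  record _≡_⟨mod_⟩ (a b : ℤ) (n : ℕ) : Set where
    constructor ⟨_⟩
    field divisibility : + n Signed.∣ a - b

  [mod]⇒⟨mod⟩ : ∀ a b n → a ≡ b [mod n ] → a ≡ b ⟨mod n ⟩
  [mod]⇒⟨mod⟩ a b n a≡b = ⟨ Signed.∣ᵤ⇒∣ {+ n} {a - b} a≡b ⟩

  ⟨mod⟩-intro : ∀ {a b n} k → a - b ≡ k * + n → a ≡ b ⟨mod n ⟩
  ⟨mod⟩-intro k eq = ⟨ Signed.divides k eq ⟩

  ⟨mod⟩-reflexive : ∀ {a b n} → a ≡ b → a ≡ b ⟨mod n ⟩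
  ⟨mod⟩-reflexive {a} {n = n} refl =
    ⟨mod⟩-intro (+ 0) (trans (ℤP.+-inverseʳ a) (sym (ℤP.*-zeroˡ (+ n))))

  ⟨mod⟩-refl : ∀ {a n} → a ≡ a ⟨mod n ⟩
  ⟨mod⟩-refl = ⟨mod⟩-reflexive refl

  ⟨mod⟩-sym : ∀ {a b n} → a ≡ b ⟨mod n ⟩ → b ≡ a ⟨mod n ⟩
  ⟨mod⟩-sym {a} {b} ⟨ n∣a-b ⟩ = ⟨ subst (Signed._∣_ _) (flip a b) (Signed.∣m⇒∣-m n∣a-b) ⟩
    where
    flip : ∀ a b → - (a - b) ≡ b - a
    flip = solve-∀

  ⟨mod⟩-trans : ∀ {a b c n} → a ≡ b ⟨mod n ⟩ → b ≡ c ⟨mod n ⟩ → a ≡ c ⟨mod n ⟩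
  ⟨mod⟩-trans {a} {b} {c} ⟨ n∣a-b ⟩ ⟨ n∣b-c ⟩ =
    ⟨ subst (Signed._∣_ _) (telescope a b c) (Signed.∣m∣n⇒∣m+n n∣a-b n∣b-c) ⟩
    where
    telescope : ∀ a b c → (a - b) + (b - c) ≡ a - c
    telescope = solve-∀

  ⟨mod⟩-+ : ∀ {a b c d n} → a ≡ b ⟨mod n ⟩ → c ≡ d ⟨mod n ⟩ → a + c ≡ b + d ⟨mod n ⟩
  ⟨mod⟩-+ {a} {b} {c} {d} ⟨ n∣a-b ⟩ ⟨ n∣c-d ⟩ =
    ⟨ subst (Signed._∣_ _) (regroup a b c d) (Signed.∣m∣n⇒∣m+n n∣a-b n∣c-d) ⟩
    where
    regroup : ∀ a b c d → (a - b) + (c - d) ≡ (a + c) - (b + d)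
    regroup = solve-∀

  ⟨mod⟩-− : ∀ {a b c d n} → a ≡ b ⟨mod n ⟩ → c ≡ d ⟨mod n ⟩ → a - c ≡ b - d ⟨mod n ⟩
  ⟨mod⟩-− {a} {b} {c} {d} ⟨ n∣a-b ⟩ ⟨ n∣c-d ⟩ =
    ⟨ subst (Signed._∣_ _) (regroup a b c d) (Signed.∣m∣n⇒∣m-n n∣a-b n∣c-d) ⟩
    where
    regroup : ∀ a b c d → (a - b) - (c - d) ≡ (a - c) - (b - d)
    regroup = solve-∀

  ⟨mod⟩-+-cancelˡ : ∀ {c a b n} → c + a ≡ c + b ⟨mod n ⟩ → a ≡ b ⟨mod n ⟩
  ⟨mod⟩-+-cancelˡ {c} {a} {b} ⟨ n∣c+a-[c+b] ⟩ = ⟨ subst (Signed._∣_ _) (cancel c a b) n∣c+a-[c+b] ⟩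
    where
    cancel : ∀ c a b → (c + a) - (c + b) ≡ a - b
    cancel = solve-∀

  ⟨mod⟩-complement : ∀ {a b c x n} → a + b ≡ c ⟨mod n ⟩ → x ≡ a ⟨mod n ⟩ → c - x ≡ b ⟨mod n ⟩
  ⟨mod⟩-complement {a} {b} a+b≡c x≡a =
    ⟨mod⟩-trans (⟨mod⟩-− (⟨mod⟩-sym a+b≡c) x≡a) (⟨mod⟩-reflexive (cancel a b))
    where
    cancel : ∀ a b → (a + b) - a ≡ b
    cancel = solve-∀

  ⟨mod⟩-*ʳ : ∀ {a b n} c → a ≡ b ⟨mod n ⟩ → a * c ≡ b * c ⟨mod n ⟩
  ⟨mod⟩-*ʳ {a} {b} c ⟨ n∣a-b ⟩ =
    ⟨ subst (Signed._∣_ _) (distrib a b c) (Signed.∣m⇒∣m*n c n∣a-b) ⟩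
    where
    distrib : ∀ a b c → (a - b) * c ≡ a * c - b * c
    distrib = solve-∀

  ⟨mod⟩-scaleˡ : ∀ {a b n} k → a ≡ b ⟨mod n ⟩ → + k * a ≡ + k * b ⟨mod k ℕ.* n ⟩
  ⟨mod⟩-scaleˡ {a} {b} {n} k ⟨ Signed.divides q eq ⟩ = ⟨mod⟩-intro q (begin
    + k * a - + k * b  ≡⟨ factor (+ k) a b ⟩
    + k * (a - b)      ≡⟨ cong (+ k *_) eq ⟩
    + k * (q * + n)    ≡⟨ swap (+ k) q (+ n) ⟩
    q * (+ k * + n)    ≡⟨ cong (q *_) (ℤP.pos-* k n) ⟨
    q * + (k ℕ.* n)    ∎)
    where
    open ≡-Reasoning
    factor : ∀ k a b → k * a - k * b ≡ k * (a - b)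
    factor = solve-∀
    swap : ∀ k q n → k * (q * n) ≡ q * (k * n)
    swap = solve-∀

  ⟨mod⟩-∣ : ∀ {a b m n} → m ℕD.∣ n → a ≡ b ⟨mod n ⟩ → a ≡ b ⟨mod m ⟩
  ⟨mod⟩-∣ {m = m} {n} m∣n ⟨ n∣a-b ⟩ = ⟨ Signed.∣-trans (Signed.∣ᵤ⇒∣ {+ m} {+ n} m∣n) n∣a-b ⟩

  ⟨mod⟩⇒∣∣-∣ : ∀ {a b n} → a ≡ b ⟨mod n ⟩ → n ℕD.∣ ℤ.∣ a - b ∣
  ⟨mod⟩⇒∣∣-∣ ⟨ n∣a-b ⟩ = Signed.∣⇒∣ᵤ n∣a-b

  ⟨mod⟩-setoid : ℕ → Setoid 0ℓ 0ℓ
  ⟨mod⟩-setoid n = record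
    { Carrier       = ℤ
    ; _≈_           = _≡_⟨mod n ⟩
    ; isEquivalence = record { refl = ⟨mod⟩-refl ; sym = ⟨mod⟩-sym ; trans = ⟨mod⟩-trans }
    }

  module ⟨mod⟩-Reasoning (n : ℕ) = SetoidReasoning (⟨mod⟩-setoid n)

  mod-⟨mod⟩ : ∀ a n .{{_ : ℕ.NonZero n}} → a ≡ + (a mod n) ⟨mod n ⟩
  mod-⟨mod⟩ a (suc n) = ⟨mod⟩-intro (a ℤ./ℕ suc n) (begin
    a - r                          ≡⟨ cong (_- r) (a≡a%ℕn+[a/ℕn]*n a (suc n)) ⟩
    r + a ℤ./ℕ suc n * + suc n - r ≡⟨ cancel r (a ℤ./ℕ suc n * + suc n) ⟩
    a ℤ./ℕ suc n * + suc n         ∎)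
    where
    open ≡-Reasoning
    r : ℤ
    r = + (a mod suc n)
    cancel : ∀ r x → r + x - r ≡ x
    cancel = solve-∀

  mod< : ∀ a n .{{_ : ℕ.NonZero n}} → a mod n ℕ.< n
  mod< a (suc n) = n%ℕd<d a (suc n)

  +n-mod : ∀ n K .{{_ : ℕ.NonZero K}} → (+ n) mod K ≡ n ℕ.% K
  +n-mod n (suc K) = refl

  ∣∧<⇒≡0 : ∀ {n x} → n ℕD.∣ x → x ℕ.< n → x ≡ 0
  ∣∧<⇒≡0 {x = zero}  _   _   = refl
  ∣∧<⇒≡0 {x = suc _} n∣x x<n = ⊥-elim (ℕD.>⇒∤ x<n n∣x)

  residue-unique : ∀ {r s n} → r ℕ.< n → s ℕ.< n → + r ≡ + s ⟨mod n ⟩ → r ≡ s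
  residue-unique {r} {s} {n} r<n s<n r≡s =
    ℤP.+-injective (ℤP.i-j≡0⇒i≡j (+ r) (+ s) (ℤP.∣i∣≡0⇒i≡0 ∣r-s∣≡0))
    where
    ∣r-s∣<n : ℤ.∣ + r - + s ∣ ℕ.< n
    ∣r-s∣<n = subst (ℕ._< n) (cong ℤ.∣_∣ (sym (ℤP.m-n≡m⊖n r s)))
      (ℕP.≤-<-trans (ℤP.∣m⊝n∣≤m⊔n r s) (ℕP.⊔-lub r<n s<n))
    ∣r-s∣≡0 : ℤ.∣ + r - + s ∣ ≡ 0
    ∣r-s∣≡0 = ∣∧<⇒≡0 (⟨mod⟩⇒∣∣-∣ r≡s) ∣r-s∣<n

  mod≡⇒⟨mod⟩ : ∀ {a r n} .{{_ : ℕ.NonZero n}} → a mod n ≡ r → a ≡ + r ⟨mod n ⟩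
  mod≡⇒⟨mod⟩ {a} {n = n} refl = mod-⟨mod⟩ a n

  ⟨mod⟩⇒mod≡ : ∀ {a r n} .{{_ : ℕ.NonZero n}} → r ℕ.< n → a ≡ + r ⟨mod n ⟩ → a mod n ≡ r
  ⟨mod⟩⇒mod≡ {a} {r} {n} r<n a≡r =
    residue-unique (mod< a n) r<n (⟨mod⟩-trans (⟨mod⟩-sym (mod-⟨mod⟩ a n)) a≡r)

  ⟨mod⟩⇒mod≡mod : ∀ {a b n} → a ≡ b ⟨mod n ⟩ → a mod n ≡ b mod n
  ⟨mod⟩⇒mod≡mod {n = zero}  _   = refl
  ⟨mod⟩⇒mod≡mod {a} {b} {suc n} a≡b =
    ⟨mod⟩⇒mod≡ (mod< b (suc n)) (⟨mod⟩-trans a≡b (mod-⟨mod⟩ b (suc n)))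

open Congruence

sgn+sgn≡2*half : ∀ s s′ → sgn s ℤ.+ sgn s′ ≡ + 2 ℤ.* half (sgn s ℤ.+ sgn s′)
sgn+sgn≡2*half Sign.+ Sign.+ = ≡.refl
sgn+sgn≡2*half Sign.+ Sign.- = ≡.refl
sgn+sgn≡2*half Sign.- Sign.+ = ≡.refl
sgn+sgn≡2*half Sign.- Sign.- = ≡.refl

sgn-sgn≡2*half : ∀ s s′ → sgn s ℤ.- sgn s′ ≡ + 2 ℤ.* half (sgn s ℤ.- sgn s′)
sgn-sgn≡2*half Sign.+ Sign.+ = ≡.refl
sgn-sgn≡2*half Sign.+ Sign.- = ≡.refl
sgn-sgn≡2*half Sign.- Sign.+ = ≡.refl
sgn-sgn≡2*half Sign.- Sign.- = ≡.refl

∣sgn∣≡1 : ∀ s → ℤ.∣ sgn s ∣ ≡ 1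
∣sgn∣≡1 Sign.+ = ≡.refl
∣sgn∣≡1 Sign.- = ≡.refl

module _ where
  open ≡ using (refl; cong₂; subst)
  open import Data.Integer using (_+_; _-_; _*_; -_)
  open import Data.Integer.Tactic.RingSolver using (solve-∀)

  halve-mod3 : ∀ {x b} → + 2 * x ≡ b ⟨mod 3 ⟩ → x ≡ + 2 * b ⟨mod 3 ⟩
  halve-mod3 {x} 2x≡b = ⟨mod⟩-trans (⟨mod⟩-intro (- x) (x-4x≡-3x x))
                                    (⟨mod⟩-∣ (ℕD.divides 2 refl) (⟨mod⟩-scaleˡ 2 2x≡b))
    where
    x-4x≡-3x : ∀ x → x - + 2 * (+ 2 * x) ≡ - x * + 3
    x-4x≡-3x = solve-∀

  3s₁+2s₂≡6a+8b : ∀ {s₁ s₂ a b} → s₁ ≡ + 2 * half s₁ → half s₁ ≡ a ⟨mod 2 ⟩ →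
                  s₂ ≡ + 2 * half s₂ → s₂ ≡ b ⟨mod 3 ⟩ →
                  + 3 * s₁ + + 2 * s₂ ≡ + 6 * a + + 8 * b ⟨mod 12 ⟩
  3s₁+2s₂≡6a+8b {s₁} {s₂} {a} {b} s₁-even h₁≡a s₂-even s₂≡b = begin
    + 3 * s₁ + + 2 * s₂
      ≡⟨ cong₂ (λ u v → + 3 * u + + 2 * v) s₁-even s₂-even ⟩
    + 3 * (+ 2 * half s₁) + + 2 * (+ 2 * half s₂)
      ≡⟨ regroup (half s₁) (half s₂) ⟩
    + 6 * half s₁ + + 4 * half s₂
      ≈⟨ ⟨mod⟩-+ (⟨mod⟩-scaleˡ 6 h₁≡a) (⟨mod⟩-scaleˡ 4 h₂≡2b) ⟩
    + 6 * a + + 4 * (+ 2 * b)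
      ≡⟨ ≡.cong (_+_ (+ 6 * a)) (ℤP.*-assoc (+ 4) (+ 2) b) ⟨
    + 6 * a + + 8 * b ∎
    where
    open ⟨mod⟩-Reasoning 12
    regroup : ∀ h₁ h₂ → + 3 * (+ 2 * h₁) + + 2 * (+ 2 * h₂) ≡ + 6 * h₁ + + 4 * h₂
    regroup = solve-∀
    h₂≡2b : half s₂ ≡ + 2 * b ⟨mod 3 ⟩
    h₂≡2b = halve-mod3 (subst (_≡ b ⟨mod 3 ⟩) s₂-even s₂≡b)

module Residues (p₃ ℓ₃ : ℕ) .{{_ : ℕ.NonZero p₃}} where
  open ≡ using (sym; trans; cong; cong₂; subst; module ≡-Reasoning)
  open import Data.Nat.Coprimality using (coprime-divisor) renaming (sym to coprime-sym)
  open import Data.Integer.Tactic.RingSolver using (solve-∀)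
  open import Data.Integer using (_+_; _-_; _*_; -_)

  D : ℕ
  D = 2 ℕ.* P p₃

  instance
    D≢0 : ℕ.NonZero D
    D≢0 = ℕP.m*n≢0 2 (6 ℕ.* p₃) {{_}} {{ℕP.m*n≢0 6 p₃}}

  X : Triple → ℤ
  X ε = + (6 ℕ.* p₃) + + (3 ℕ.* p₃) * ε₁ ε + + (2 ℕ.* p₃) * ε₂ ε + + (6 ℕ.* ℓ₃) * ε₃ ε

  m≡X : ∀ ε → + m p₃ ℓ₃ ε ≡ X ε ⟨mod D ⟩
  m≡X ε = ⟨mod⟩-sym (mod-⟨mod⟩ (X ε) D)

  m<D : ∀ ε → m p₃ ℓ₃ ε ℕ.< D
  m<D ε = mod< (X ε) D

  X-expand : ∀ ε → X ε ≡ + p₃ * (+ 6 + + 3 * ε₁ ε + + 2 * ε₂ ε) + + 6 * + ℓ₃ * ε₃ ε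
  X-expand ε = trans casts (regroup (+ p₃) (+ ℓ₃) (ε₁ ε) (ε₂ ε) (ε₃ ε))
    where
    casts : X ε ≡ + 6 * + p₃ + + 3 * + p₃ * ε₁ ε + + 2 * + p₃ * ε₂ ε + + 6 * + ℓ₃ * ε₃ ε
    casts = cong₂ _+_ (cong₂ _+_ (cong₂ _+_ (ℤP.pos-* 6 p₃) (cong (_* ε₁ ε) (ℤP.pos-* 3 p₃)))
                                 (cong (_* ε₂ ε) (ℤP.pos-* 2 p₃)))
                      (cong (_* ε₃ ε) (ℤP.pos-* 6 ℓ₃))
    regroup : ∀ P L e₁ e₂ e₃ → + 6 * P + + 3 * P * e₁ + + 2 * P * e₂ + + 6 * L * e₃
                             ≡ P * (+ 6 + + 3 * e₁ + + 2 * e₂) + + 6 * L * e₃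
    regroup = solve-∀

  D≡p₃*12 : D ≡ p₃ ℕ.* 12
  D≡p₃*12 = identity p₃
    where
    open import Data.Nat.Tactic.RingSolver using () renaming (solve-∀ to ℕ-solve-∀)
    identity : ∀ p → 2 ℕ.* (6 ℕ.* p) ≡ p ℕ.* 12
    identity = ℕ-solve-∀

  scale-to-D : ∀ {a b} → a ≡ b ⟨mod 12 ⟩ → + p₃ * a ≡ + p₃ * b ⟨mod D ⟩
  scale-to-D {a} {b} a≡b = subst (+ p₃ * a ≡ + p₃ * b ⟨mod_⟩) (sym D≡p₃*12) (⟨mod⟩-scaleˡ p₃ a≡b)

  p₃*[12+t]≡p₃*t : ∀ t → + p₃ * (+ 12 + t) ≡ + p₃ * t ⟨mod D ⟩
  p₃*[12+t]≡p₃*t t = ⟨mod⟩-intro (+ 1) (begin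
    + p₃ * (+ 12 + t) - + p₃ * t ≡⟨ identity (+ p₃) t ⟩
    + 1 * (+ p₃ * + 12)          ≡⟨ cong (+ 1 *_) (ℤP.pos-* p₃ 12) ⟨
    + 1 * + (p₃ ℕ.* 12)          ≡⟨ cong (λ n → + 1 * + n) D≡p₃*12 ⟨
    + 1 * + D                    ∎)
    where
    open ≡-Reasoning
    identity : ∀ p t → p * (+ 12 + t) - p * t ≡ + 1 * (p * + 12)
    identity = solve-∀

  X+X′ : ∀ ε ε′ → ε₃ ε + ε₃ ε′ ≡ + 0 →
         X ε + X ε′ ≡ + p₃ * (+ 12 + (+ 3 * (ε₁ ε + ε₁ ε′) + + 2 * (ε₂ ε + ε₂ ε′)))
  X+X′ ε ε′ e₃+f₃≡0 = begin
    X ε + X ε′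
      ≡⟨ cong₂ _+_ (X-expand ε) (X-expand ε′) ⟩
    + p₃ * (+ 6 + + 3 * ε₁ ε + + 2 * ε₂ ε) + + 6 * + ℓ₃ * ε₃ ε
      + (+ p₃ * (+ 6 + + 3 * ε₁ ε′ + + 2 * ε₂ ε′) + + 6 * + ℓ₃ * ε₃ ε′)
      ≡⟨ regroup (+ p₃) (+ ℓ₃) (ε₁ ε) (ε₂ ε) (ε₃ ε) (ε₁ ε′) (ε₂ ε′) (ε₃ ε′) ⟩
    + p₃ * (+ 12 + t) + + 6 * + ℓ₃ * (ε₃ ε + ε₃ ε′)
      ≡⟨ cong (λ z → + p₃ * (+ 12 + t) + + 6 * + ℓ₃ * z) e₃+f₃≡0 ⟩
    + p₃ * (+ 12 + t) + + 6 * + ℓ₃ * + 0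
      ≡⟨ drop-zero (+ p₃ * (+ 12 + t)) (+ ℓ₃) ⟩
    + p₃ * (+ 12 + t) ∎
    where
    open ≡-Reasoning
    t : ℤ
    t = + 3 * (ε₁ ε + ε₁ ε′) + + 2 * (ε₂ ε + ε₂ ε′)
    regroup : ∀ P L e₁ e₂ e₃ f₁ f₂ f₃ →
      P * (+ 6 + + 3 * e₁ + + 2 * e₂) + + 6 * L * e₃ + (P * (+ 6 + + 3 * f₁ + + 2 * f₂) + + 6 * L * f₃)
      ≡ P * (+ 12 + (+ 3 * (e₁ + f₁) + + 2 * (e₂ + f₂))) + + 6 * L * (e₃ + f₃)
    regroup = solve-∀
    drop-zero : ∀ x L → x + + 6 * L * + 0 ≡ x
    drop-zero = solve-∀

  X-X′ : ∀ ε ε′ → ε₃ ε - ε₃ ε′ ≡ + 0 →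
         X ε - X ε′ ≡ + p₃ * (+ 3 * (ε₁ ε - ε₁ ε′) + + 2 * (ε₂ ε - ε₂ ε′))
  X-X′ ε ε′ e₃-f₃≡0 = begin
    X ε - X ε′
      ≡⟨ cong₂ _-_ (X-expand ε) (X-expand ε′) ⟩
    + p₃ * (+ 6 + + 3 * ε₁ ε + + 2 * ε₂ ε) + + 6 * + ℓ₃ * ε₃ ε
      - (+ p₃ * (+ 6 + + 3 * ε₁ ε′ + + 2 * ε₂ ε′) + + 6 * + ℓ₃ * ε₃ ε′)
      ≡⟨ regroup (+ p₃) (+ ℓ₃) (ε₁ ε) (ε₂ ε) (ε₃ ε) (ε₁ ε′) (ε₂ ε′) (ε₃ ε′) ⟩
    + p₃ * t + + 6 * + ℓ₃ * (ε₃ ε - ε₃ ε′)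
      ≡⟨ cong (λ z → + p₃ * t + + 6 * + ℓ₃ * z) e₃-f₃≡0 ⟩
    + p₃ * t + + 6 * + ℓ₃ * + 0
      ≡⟨ drop-zero (+ p₃ * t) (+ ℓ₃) ⟩
    + p₃ * t ∎
    where
    open ≡-Reasoning
    t : ℤ
    t = + 3 * (ε₁ ε - ε₁ ε′) + + 2 * (ε₂ ε - ε₂ ε′)
    regroup : ∀ P L e₁ e₂ e₃ f₁ f₂ f₃ →
      P * (+ 6 + + 3 * e₁ + + 2 * e₂) + + 6 * L * e₃ - (P * (+ 6 + + 3 * f₁ + + 2 * f₂) + + 6 * L * f₃)
      ≡ P * (+ 3 * (e₁ - f₁) + + 2 * (e₂ - f₂)) + + 6 * L * (e₃ - f₃)
    regroup = solve-∀
    drop-zero : ∀ x L → x + + 6 * L * + 0 ≡ x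
    drop-zero = solve-∀

  m+m′≡p₃[6a+8b] : ∀ ε ε′ a b → half (ε₁ ε + ε₁ ε′) ≡ a [mod 2 ] →
                   ε₂ ε + ε₂ ε′ ≡ b [mod 3 ] → ε₃ ε + ε₃ ε′ ≡ + 0 →
                   + m p₃ ℓ₃ ε + + m p₃ ℓ₃ ε′ ≡ + p₃ * (+ 6 * a + + 8 * b) ⟨mod D ⟩
  m+m′≡p₃[6a+8b] ε@(s₁ , s₂ , _) ε′@(s₁′ , s₂′ , _) a b h₁≡a s₂≡b e₃+f₃≡0 = begin
    + m p₃ ℓ₃ ε + + m p₃ ℓ₃ ε′  ≈⟨ ⟨mod⟩-+ (m≡X ε) (m≡X ε′) ⟩
    X ε + X ε′                  ≡⟨ X+X′ ε ε′ e₃+f₃≡0 ⟩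
    + p₃ * (+ 12 + t)           ≈⟨ p₃*[12+t]≡p₃*t t ⟩
    + p₃ * t                    ≈⟨ scale-to-D t≡6a+8b ⟩
    + p₃ * (+ 6 * a + + 8 * b)  ∎
    where
    open ⟨mod⟩-Reasoning D
    t : ℤ
    t = + 3 * (ε₁ ε + ε₁ ε′) + + 2 * (ε₂ ε + ε₂ ε′)
    t≡6a+8b : t ≡ + 6 * a + + 8 * b ⟨mod 12 ⟩
    t≡6a+8b = 3s₁+2s₂≡6a+8b (sgn+sgn≡2*half s₁ s₁′) ([mod]⇒⟨mod⟩ _ a 2 h₁≡a)
                            (sgn+sgn≡2*half s₂ s₂′) ([mod]⇒⟨mod⟩ _ b 3 s₂≡b)

  m-m′≡p₃[6a+8b] : ∀ ε ε′ a b → half (ε₁ ε - ε₁ ε′) ≡ a [mod 2 ] →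
                   ε₂ ε - ε₂ ε′ ≡ b [mod 3 ] → ε₃ ε - ε₃ ε′ ≡ + 0 →
                   + m p₃ ℓ₃ ε - + m p₃ ℓ₃ ε′ ≡ + p₃ * (+ 6 * a + + 8 * b) ⟨mod D ⟩
  m-m′≡p₃[6a+8b] ε@(s₁ , s₂ , _) ε′@(s₁′ , s₂′ , _) a b h₁≡a s₂≡b e₃-f₃≡0 = begin
    + m p₃ ℓ₃ ε - + m p₃ ℓ₃ ε′  ≈⟨ ⟨mod⟩-− (m≡X ε) (m≡X ε′) ⟩
    X ε - X ε′                  ≡⟨ X-X′ ε ε′ e₃-f₃≡0 ⟩
    + p₃ * t                    ≈⟨ scale-to-D t≡6a+8b ⟩
    + p₃ * (+ 6 * a + + 8 * b)  ∎
    where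
    open ⟨mod⟩-Reasoning D
    t : ℤ
    t = + 3 * (ε₁ ε - ε₁ ε′) + + 2 * (ε₂ ε - ε₂ ε′)
    t≡6a+8b : t ≡ + 6 * a + + 8 * b ⟨mod 12 ⟩
    t≡6a+8b = 3s₁+2s₂≡6a+8b (sgn-sgn≡2*half s₁ s₁′) ([mod]⇒⟨mod⟩ _ a 2 h₁≡a)
                            (sgn-sgn≡2*half s₂ s₂′) ([mod]⇒⟨mod⟩ _ b 3 s₂≡b)

  p₃∣D : p₃ ℕD.∣ D
  p₃∣D = ℕD.divides 12 (trans D≡p₃*12 (ℕP.*-comm p₃ 12))

  X≡6ℓ₃ε₃ : ∀ ε → X ε ≡ + 6 * + ℓ₃ * ε₃ ε ⟨mod p₃ ⟩
  X≡6ℓ₃ε₃ ε = ⟨mod⟩-intro (+ 6 + + 3 * ε₁ ε + + 2 * ε₂ ε) (begin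
    X ε - + 6 * + ℓ₃ * ε₃ ε
      ≡⟨ cong (_- + 6 * + ℓ₃ * ε₃ ε) (X-expand ε) ⟩
    + p₃ * (+ 6 + + 3 * ε₁ ε + + 2 * ε₂ ε) + + 6 * + ℓ₃ * ε₃ ε - + 6 * + ℓ₃ * ε₃ ε
      ≡⟨ cancel (+ p₃) (+ 6 + + 3 * ε₁ ε + + 2 * ε₂ ε) (+ 6 * + ℓ₃ * ε₃ ε) ⟩
    (+ 6 + + 3 * ε₁ ε + + 2 * ε₂ ε) * + p₃ ∎)
    where
    open ≡-Reasoning
    cancel : ∀ p s x → p * s + x - x ≡ s * p
    cancel = solve-∀

  m≢multiple-of-p₃ : Coprime 6 p₃ → 0 ℕ.< ℓ₃ → ℓ₃ ℕ.< p₃ →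
                     ∀ ε w → ¬ (+ (p₃ ℕ.* w) ≡ + m p₃ ℓ₃ ε ⟨mod D ⟩)
  m≢multiple-of-p₃ 6⊥p₃ 0<ℓ₃ ℓ₃<p₃ ε@(_ , _ , s₃) w p₃w≡m =
    ℕP.<⇒≱ ℓ₃<p₃ (ℕD.∣⇒≤ {{ℕ.>-nonZero 0<ℓ₃}} (coprime-divisor (coprime-sym 6⊥p₃) p₃∣6ℓ₃))
    where
    6ℓ₃ε₃≡0 : + 6 * + ℓ₃ * ε₃ ε ≡ + 0 ⟨mod p₃ ⟩
    6ℓ₃ε₃≡0 = begin
      + 6 * + ℓ₃ * ε₃ ε   ≈⟨ ⟨mod⟩-sym (X≡6ℓ₃ε₃ ε) ⟩
      X ε                 ≈⟨ ⟨mod⟩-∣ p₃∣D (⟨mod⟩-sym (m≡X ε)) ⟩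
      + m p₃ ℓ₃ ε         ≈⟨ ⟨mod⟩-∣ p₃∣D (⟨mod⟩-sym p₃w≡m) ⟩
      + (p₃ ℕ.* w)        ≈⟨ p₃w≡0 ⟩
      + 0                 ∎
      where
      open ⟨mod⟩-Reasoning p₃
      p₃w≡0 : + (p₃ ℕ.* w) ≡ + 0 ⟨mod p₃ ⟩
      p₃w≡0 = ⟨mod⟩-intro (+ w) (trans (ℤP.+-identityʳ (+ (p₃ ℕ.* w)))
                                       (trans (ℤP.pos-* p₃ w) (ℤP.*-comm (+ p₃) (+ w))))
    ∣6ℓ₃ε₃∣≡6*ℓ₃ : ℤ.∣ + 6 * + ℓ₃ * ε₃ ε - + 0 ∣ ≡ 6 ℕ.* ℓ₃
    ∣6ℓ₃ε₃∣≡6*ℓ₃ = begin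
      ℤ.∣ + 6 * + ℓ₃ * ε₃ ε - + 0 ∣      ≡⟨ cong ℤ.∣_∣ (ℤP.+-identityʳ (+ 6 * + ℓ₃ * ε₃ ε)) ⟩
      ℤ.∣ + 6 * + ℓ₃ * ε₃ ε ∣            ≡⟨ ℤP.abs-* (+ 6 * + ℓ₃) (ε₃ ε) ⟩
      ℤ.∣ + 6 * + ℓ₃ ∣ ℕ.* ℤ.∣ sgn s₃ ∣
        ≡⟨ cong₂ ℕ._*_ (ℤP.abs-* (+ 6) (+ ℓ₃)) (∣sgn∣≡1 s₃) ⟩
      6 ℕ.* ℓ₃ ℕ.* 1                     ≡⟨ ℕP.*-identityʳ _ ⟩
      6 ℕ.* ℓ₃                           ∎
      where open ≡-Reasoning
    p₃∣6ℓ₃ : p₃ ℕD.∣ 6 ℕ.* ℓ₃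
    p₃∣6ℓ₃ = subst (p₃ ℕD.∣_) ∣6ℓ₃ε₃∣≡6*ℓ₃ (⟨mod⟩⇒∣∣-∣ 6ℓ₃ε₃≡0)

module _ where
  open ≡ using (cong; trans; module ≡-Reasoning)
  import Data.Rational.Unnormalised as Q
  open import Data.Integer using (_+_; _-_; _*_; -_)
  open import Data.Integer.Tactic.RingSolver using (solve-∀)

  -- With D and d successors, ↥ (a / D − n / d) * ↧ (q / 1) computes to the
  -- first line of the chain below.
  ⟨mod⟩⇒÷≡[mod1] : ∀ {a n} D d e .{{_ : ℕ.NonZero D}} .{{_ : ℕ.NonZero d}} → D ≡ d ℕ.* e →
                   a ≡ + (e ℕ.* n) ⟨mod D ⟩ → (a ÷ D) ≡ ((+ n) ÷ d) [mod1]
  ⟨mod⟩⇒÷≡[mod1] {a} {n} (suc D) (suc d) e D≡de ⟨ Signed.divides q eq ⟩ = q , Q.*≡* (begin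
    (a * δ + - + n * Δ) * + 1         ≡⟨ cong (λ x → (a * δ + - + n * x) * + 1) Δ≡δ*e ⟩
    (a * δ + - + n * (δ * + e)) * + 1 ≡⟨ factor a (+ n) δ (+ e) ⟩
    δ * (a - + e * + n)               ≡⟨ cong (λ x → δ * (a - x)) (ℤP.pos-* e n) ⟨
    δ * (a - + (e ℕ.* n))             ≡⟨ cong (δ *_) eq ⟩
    δ * (q * Δ)                       ≡⟨ swap δ q Δ ⟩
    q * (Δ * δ)                       ≡⟨ cong (q *_) (ℤP.pos-* (suc D) (suc d)) ⟨
    q * + (suc D ℕ.* suc d)           ∎)
    where
    open ≡-Reasoning
    δ Δ : ℤ
    δ = + suc d
    Δ = + suc D
    Δ≡δ*e : Δ ≡ δ * + e
    Δ≡δ*e = trans (cong +_ D≡de) (ℤP.pos-* (suc d) e)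
    factor : ∀ a n δ e → (a * δ + - n * (δ * e)) * + 1 ≡ δ * (a - e * n)
    factor = solve-∀
    swap : ∀ δ q Δ → δ * (q * Δ) ≡ q * (Δ * δ)
    swap = solve-∀

module IndexArithmetic where
  open import Data.Nat.Tactic.RingSolver using (solve-∀)

  reflect-index : ∀ {lo lo′ L A i} → lo ℕ.+ lo′ ℕ.+ L ≡ suc A → i ℕ.< L →
                  lo ℕ.+ (L ℕ.∸ suc i) ≡ A ℕ.∸ (lo′ ℕ.+ i)
  reflect-index {lo} {lo′} {L} {A} {i} window i<L = ≡.sym (begin
    A ℕ.∸ (lo′ ℕ.+ i)                       ≡⟨ ≡.cong (ℕ._∸ (lo′ ℕ.+ i)) A≡ ⟩
    lo ℕ.+ k ℕ.+ (lo′ ℕ.+ i) ℕ.∸ (lo′ ℕ.+ i) ≡⟨ ℕP.m+n∸n≡m (lo ℕ.+ k) (lo′ ℕ.+ i) ⟩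
    lo ℕ.+ k                                 ∎)
    where
    open ≡.≡-Reasoning
    k : ℕ
    k = L ℕ.∸ suc i
    regroup : ∀ lo lo′ i k → lo ℕ.+ lo′ ℕ.+ (suc i ℕ.+ k) ≡ suc (lo ℕ.+ k ℕ.+ (lo′ ℕ.+ i))
    regroup = solve-∀
    A≡ : A ≡ lo ℕ.+ k ℕ.+ (lo′ ℕ.+ i)
    A≡ = ℕP.suc-injective (≡.trans (≡.sym window)
           (≡.trans (≡.cong (lo ℕ.+ lo′ ℕ.+_) (≡.sym (ℕP.m+[n∸m]≡n i<L))) (regroup lo lo′ i k)))

  reflect-bound : ∀ {lo lo′ L A i} → lo ℕ.+ lo′ ℕ.+ L ≡ suc A → i ℕ.< L → lo′ ℕ.+ i ℕ.≤ A
  reflect-bound {lo} {lo′} {L} {A} {i} window i<L = ℕP.≤-pred (begin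
    suc (lo′ ℕ.+ i)      ≡⟨ ℕP.+-suc lo′ i ⟨
    lo′ ℕ.+ suc i        ≤⟨ ℕP.+-monoʳ-≤ lo′ i<L ⟩
    lo′ ℕ.+ L            ≤⟨ ℕP.m≤n+m (lo′ ℕ.+ L) lo ⟩
    lo ℕ.+ (lo′ ℕ.+ L)   ≡⟨ ℕP.+-assoc lo lo′ L ⟨
    lo ℕ.+ lo′ ℕ.+ L     ≡⟨ window ⟩
    suc A                ∎)
    where open ℕP.≤-Reasoning

module FiniteSums {c ℓ : Level} (R : CommutativeRing c ℓ) where
  open CommutativeRing R
  open import Algebra.Properties.Semiring.Sum semiring
    using (sum-syntax; sum-cong-≋; sum-cong-≗; sum-permute; sum-replicate-zero; sum-init-last)
  open import Data.Fin.Permutation using (reverse)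
  open import Data.Fin.Properties using (opposite-prop; toℕ<n; toℕ-inject₁; toℕ-fromℕ)
  open SetoidReasoning setoid
  open IndexArithmetic

  ∑-reflect : ∀ {lo lo′ L A} (g : ℕ → Carrier) → lo ℕ.+ lo′ ℕ.+ L ≡ suc A →
              ∑[ j < L ] g (lo ℕ.+ toℕ j) ≈ ∑[ j < L ] g (A ℕ.∸ (lo′ ℕ.+ toℕ j))
  ∑-reflect {lo} {lo′} {L} {A} g window = begin
    ∑[ j < L ] g (lo ℕ.+ toℕ j)                       ≈⟨ sum-permute {L} (λ j → g (lo ℕ.+ toℕ j)) reverse ⟩
    ∑[ j < L ] g (lo ℕ.+ toℕ (opposite j))   ≡⟨ sum-cong-≗ {L} (λ j → ≡.cong g (reflected j)) ⟩
    ∑[ j < L ] g (A ℕ.∸ (lo′ ℕ.+ toℕ j))             ∎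
    where
    reflected : ∀ j → lo ℕ.+ toℕ (opposite j) ≡ A ℕ.∸ (lo′ ℕ.+ toℕ j)
    reflected j = ≡.trans (≡.cong (lo ℕ.+_) (opposite-prop j)) (reflect-index window (toℕ<n j))

  select : ∀ {A : Set} → Dec A → Carrier → Carrier
  select (yes _) x = x
  select (no _)  _ = 0#

  select-yes : ∀ {A : Set} (a? : Dec A) {x} → A → select a? x ≈ x
  select-yes (yes _) _ = refl
  select-yes (no ¬a) a = ⊥-elim (¬a a)

  select-no : ∀ {A : Set} (a? : Dec A) {x} → ¬ A → select a? x ≈ 0#
  select-no (yes a) ¬a = ⊥-elim (¬a a)
  select-no (no _)  _  = refl

  select-transfer : ∀ {A B : Set} (a? : Dec A) (b? : Dec B) {x y z} →
                    (A → B) → (B → A) → (B → x ≈ z * y) → select a? x ≈ z * select b? y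
  select-transfer (yes a) (yes b) A⇒B B⇒A x≈zy = x≈zy b
  select-transfer (yes a) (no ¬b) A⇒B B⇒A x≈zy = ⊥-elim (¬b (A⇒B a))
  select-transfer (no ¬a) (yes b) A⇒B B⇒A x≈zy = ⊥-elim (¬a (B⇒A b))
  select-transfer (no ¬a) (no ¬b) A⇒B B⇒A x≈zy = sym (zeroʳ _)

  foldr-filter : ∀ {P : ℕ → Set} (P? : Decidable P) (f : ℕ → Carrier) xs →
                 foldr _+_ 0# (map f (filter P? xs)) ≈ foldr _+_ 0# (map (λ n → select (P? n) (f n)) xs)
  foldr-filter P? f []       = refl
  foldr-filter P? f (x ∷ xs) with P? x
  ... | yes _ = +-congˡ (foldr-filter P? f xs)
  ... | no _  = trans (foldr-filter P? f xs) (sym (+-identityˡ _))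

  foldr-applyUpTo : ∀ (f : ℕ → Carrier) (h : ℕ → ℕ) n →
                    foldr _+_ 0# (map f (applyUpTo h n)) ≡ ∑[ i < n ] f (h (toℕ i))
  foldr-applyUpTo f h zero    = ≡.refl
  foldr-applyUpTo f h (suc n) = ≡.cong (_+_ (f (h 0))) (foldr-applyUpTo f (λ i → h (suc i)) n)

  ∑-split : ∀ m n (g : ℕ → Carrier) →
            ∑[ i < m ℕ.+ n ] g (toℕ i) ≈ ∑[ i < m ] g (toℕ i) + ∑[ j < n ] g (m ℕ.+ toℕ j)
  ∑-split zero    n g = sym (+-identityˡ _)
  ∑-split (suc m) n g = trans (+-congˡ (∑-split m n (λ i → g (suc i)))) (sym (+-assoc _ _ _))

  ∑-zero : ∀ n (g : Fin n → Carrier) → (∀ i → g i ≈ 0#) → ∑[ i < n ] g i ≈ 0#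
  ∑-zero n g g≈0 = trans (sum-cong-≋ {n} g≈0) (sum-replicate-zero n)

  ΣRange≈∑ : ∀ {ζ K} lo hi d r (f : ℕ → Carrier) L → suc hi ≡ lo ℕ.+ L →
             RootsOfUnity.ΣRange R ζ K lo hi d r f
               ≈ ∑[ j < L ] select ((+ (lo ℕ.+ toℕ j)) mod d ℕ.≟ r) (f (lo ℕ.+ toℕ j))
  ΣRange≈∑ lo hi d r f L window = begin
    foldr _+_ 0# (map f (filter in-class? (filter in-window? (applyUpTo (λ n → n) (suc hi)))))
      ≈⟨ foldr-filter in-class? f (filter in-window? (applyUpTo (λ n → n) (suc hi))) ⟩
    foldr _+_ 0# (map (λ n → select (in-class? n) (f n)) (filter in-window? (applyUpTo (λ n → n) (suc hi))))
      ≈⟨ foldr-filter in-window? (λ n → select (in-class? n) (f n)) (applyUpTo (λ n → n) (suc hi)) ⟩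
    foldr _+_ 0# (map g (applyUpTo (λ n → n) (suc hi)))
      ≡⟨ foldr-applyUpTo g (λ n → n) (suc hi) ⟩
    ∑[ i < suc hi ] g (toℕ i)
      ≡⟨ ≡.cong (λ n → ∑[ i < n ] g (toℕ i)) window ⟩
    ∑[ i < lo ℕ.+ L ] g (toℕ i)
      ≈⟨ ∑-split lo L g ⟩
    ∑[ i < lo ] g (toℕ i) + ∑[ j < L ] g (lo ℕ.+ toℕ j)
      ≈⟨ +-cong (∑-zero lo _ (λ i → select-no (in-window? (toℕ i)) (ℕP.<⇒≱ (toℕ<n i))))
                (sum-cong-≋ {L} (λ j → select-yes (in-window? (lo ℕ.+ toℕ j)) (ℕP.m≤m+n lo (toℕ j)))) ⟩
    0# + ∑[ j < L ] select (in-class? (lo ℕ.+ toℕ j)) (f (lo ℕ.+ toℕ j))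
      ≈⟨ +-identityˡ _ ⟩
    ∑[ j < L ] select (in-class? (lo ℕ.+ toℕ j)) (f (lo ℕ.+ toℕ j)) ∎
    where
    in-class? : Decidable (λ n → (+ n) mod d ≡ r)
    in-class? n = (+ n) mod d ℕ.≟ r
    in-window? : Decidable (lo ℕ.≤_)
    in-window? n = lo ℕ.≤? n
    g : ℕ → Carrier
    g n = select (in-window? n) (select (in-class? n) (f n))

  ∑-drop-last : ∀ n (g : ℕ → Carrier) → g n ≈ 0# → ∑[ j < suc n ] g (toℕ j) ≈ ∑[ j < n ] g (toℕ j)
  ∑-drop-last n g gn≈0 = begin
    ∑[ j < suc n ] g (toℕ j)
      ≈⟨ sum-init-last {n} (λ j → g (toℕ j)) ⟩
    ∑[ j < n ] g (toℕ (inject₁ j)) + g (toℕ (fromℕ n))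
      ≡⟨ ≡.cong₂ _+_ (sum-cong-≗ {n} (λ j → ≡.cong g (toℕ-inject₁ j))) (≡.cong g (toℕ-fromℕ n)) ⟩
    ∑[ j < n ] g (toℕ j) + g n  ≈⟨ +-congˡ gn≈0 ⟩
    ∑[ j < n ] g (toℕ j) + 0#   ≈⟨ +-identityʳ _ ⟩
    ∑[ j < n ] g (toℕ j)        ∎

  ∑-drop-first : ∀ n (g : ℕ → Carrier) → g 0 ≈ 0# → ∑[ j < suc n ] g (toℕ j) ≈ ∑[ j < n ] g (suc (toℕ j))
  ∑-drop-first n g g0≈0 = trans (+-congʳ g0≈0) (+-identityˡ _)

module RootOfUnity {c ℓ : Level} (R : CommutativeRing c ℓ) (ζ : CommutativeRing.Carrier R) (K : ℕ) where
  open CommutativeRing R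
  open RootsOfUnity R ζ K
  open FiniteSums R
  open import Algebra.Properties.Semiring.Exp semiring using (_^_; ^-homo-*; ^-assocʳ; ^-congˡ)
  open import Algebra.Properties.Semiring.Sum semiring using (sum-syntax; sum-cong-≋; sum-cong-≗; *-distribˡ-sum)
  open import Data.Nat.DivMod using (m≡m%n+[m/n]*n; m*n/n≡m)
  open import Data.Integer.Tactic.RingSolver using (solve-∀)
  open import Data.Fin.Properties using (toℕ<n)
  open IndexArithmetic using (reflect-bound)

  ζ^ℤ-cong : ∀ {a b} → a ≡ b ⟨mod K ⟩ → ζ^ℤ a ≡ ζ^ℤ b
  ζ^ℤ-cong a≡b = ≡.cong (ζ ^_) (⟨mod⟩⇒mod≡mod a≡b)

  1^n≈1 : ∀ n → 1# ^ n ≈ 1#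
  1^n≈1 zero    = refl
  1^n≈1 (suc n) = trans (*-identityˡ (1# ^ n)) (1^n≈1 n)

  module Periodic .{{_ : ℕ.NonZero K}} (ζ^K≈1 : ζ ^ K ≈ 1#) where

    ζ^n≈ζ^ℤn : ∀ n → ζ ^ n ≈ ζ^ℤ (+ n)
    ζ^n≈ζ^ℤn n = begin
      ζ ^ n                          ≡⟨ ≡.cong (ζ ^_) (m≡m%n+[m/n]*n n K) ⟩
      ζ ^ (n ℕ.% K ℕ.+ n ℕ./ K ℕ.* K) ≈⟨ ^-homo-* ζ (n ℕ.% K) (n ℕ./ K ℕ.* K) ⟩
      ζ ^ (n ℕ.% K) * ζ ^ (n ℕ./ K ℕ.* K)
        ≡⟨ ≡.cong (λ e → ζ ^ (n ℕ.% K) * ζ ^ e) (ℕP.*-comm (n ℕ./ K) K) ⟩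
      ζ ^ (n ℕ.% K) * ζ ^ (K ℕ.* (n ℕ./ K)) ≈⟨ *-congˡ (^-assocʳ ζ K (n ℕ./ K)) ⟨
      ζ ^ (n ℕ.% K) * (ζ ^ K) ^ (n ℕ./ K)
        ≈⟨ *-congˡ (trans (^-congˡ (n ℕ./ K) ζ^K≈1) (1^n≈1 (n ℕ./ K))) ⟩
      ζ ^ (n ℕ.% K) * 1#                    ≈⟨ *-identityʳ (ζ ^ (n ℕ.% K)) ⟩
      ζ ^ (n ℕ.% K)                         ≡⟨ ≡.cong (ζ ^_) (+n-mod n K) ⟨
      ζ^ℤ (+ n)                             ∎
      where open SetoidReasoning setoid

    ζ^ℤ-+ : ∀ a b → ζ^ℤ (a ℤ.+ b) ≈ ζ^ℤ a * ζ^ℤ b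
    ζ^ℤ-+ a b = begin
      ζ^ℤ (a ℤ.+ b)                    ≡⟨ ζ^ℤ-cong a+b≡ra+rb ⟩
      ζ^ℤ (+ (a mod K ℕ.+ b mod K))    ≈⟨ ζ^n≈ζ^ℤn (a mod K ℕ.+ b mod K) ⟨
      ζ ^ (a mod K ℕ.+ b mod K)        ≈⟨ ^-homo-* ζ (a mod K) (b mod K) ⟩
      ζ^ℤ a * ζ^ℤ b                    ∎
      where
      open SetoidReasoning setoid
      a+b≡ra+rb : a ℤ.+ b ≡ + (a mod K ℕ.+ b mod K) ⟨mod K ⟩
      a+b≡ra+rb = ⟨mod⟩-trans (⟨mod⟩-+ (mod-⟨mod⟩ a K) (mod-⟨mod⟩ b K))
                              (⟨mod⟩-reflexive (≡.sym (ℤP.pos-+ (a mod K) (b mod K))))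

    module Quadratic (M : ℕ) where

      q : ℕ → Carrier
      q n = ζ^ℤ (+ (M ℕ.* (n ℕ.* n)))

      e2πi≡ζ^ℤ : ∀ {d h x y} .{{_ : ℕ.NonZero d}} → K ≡ 4 ℕ.* h ℕ.* d → x ≡ y ⟨mod d ⟩ →
                 e2πi[ x ℤ.* + M / d ] ≈ ζ^ℤ (+ (4 ℕ.* h) ℤ.* (y ℤ.* + M))
      e2πi≡ζ^ℤ {d} {h} {x} {y} K≡4hd x≡y = begin
        ζ^ℤ (x ℤ.* + M ℤ.* + (K ℕ./ d))     ≡⟨ ≡.cong (λ k → ζ^ℤ (x ℤ.* + M ℤ.* + k)) K/d≡4h ⟩
        ζ^ℤ (x ℤ.* + M ℤ.* + (4 ℕ.* h))     ≡⟨ ≡.cong ζ^ℤ (ℤP.*-comm (x ℤ.* + M) (+ (4 ℕ.* h))) ⟩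
        ζ^ℤ (+ (4 ℕ.* h) ℤ.* (x ℤ.* + M))   ≡⟨ ζ^ℤ-cong (≡.subst (_ ≡ _ ⟨mod_⟩) (≡.sym K≡4hd)
                                                 (⟨mod⟩-scaleˡ (4 ℕ.* h) (⟨mod⟩-*ʳ (+ M) x≡y))) ⟩
        ζ^ℤ (+ (4 ℕ.* h) ℤ.* (y ℤ.* + M))   ∎
        where
        open SetoidReasoning setoid
        K/d≡4h : K ℕ./ d ≡ 4 ℕ.* h
        K/d≡4h = ≡.trans (≡.cong (ℕ._/ d) K≡4hd) (m*n/n≡m (4 ℕ.* h) d)

      ζ^ℤ-square-shift : ∀ {d h x} .{{_ : ℕ.NonZero d}} s → K ≡ 4 ℕ.* h ℕ.* d →
        x ≡ + h ℤ.+ s ⟨mod d ⟩ →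
        ζ^ℤ (+ M ℤ.* ((+ (2 ℕ.* h) ℤ.+ s) ℤ.* (+ (2 ℕ.* h) ℤ.+ s)))
          ≈ e2πi[ x ℤ.* + M / d ] * ζ^ℤ (+ M ℤ.* (s ℤ.* s))
      ζ^ℤ-square-shift {d} {h} {x} s K≡4hd x≡h+s = begin
        ζ^ℤ (+ M ℤ.* ((+ (2 ℕ.* h) ℤ.+ s) ℤ.* (+ (2 ℕ.* h) ℤ.+ s)))
          ≡⟨ ≡.cong ζ^ℤ expand ⟩
        ζ^ℤ (+ (4 ℕ.* h) ℤ.* ((+ h ℤ.+ s) ℤ.* + M) ℤ.+ + M ℤ.* (s ℤ.* s))
          ≈⟨ ζ^ℤ-+ _ _ ⟩
        ζ^ℤ (+ (4 ℕ.* h) ℤ.* ((+ h ℤ.+ s) ℤ.* + M)) * ζ^ℤ (+ M ℤ.* (s ℤ.* s))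
          ≈⟨ *-congʳ (e2πi≡ζ^ℤ {h = h} K≡4hd x≡h+s) ⟨
        e2πi[ x ℤ.* + M / d ] * ζ^ℤ (+ M ℤ.* (s ℤ.* s)) ∎
        where
        open SetoidReasoning setoid
        identity : ∀ h s m → m ℤ.* ((+ 2 ℤ.* h ℤ.+ s) ℤ.* (+ 2 ℤ.* h ℤ.+ s))
                             ≡ + 4 ℤ.* h ℤ.* ((h ℤ.+ s) ℤ.* m) ℤ.+ m ℤ.* (s ℤ.* s)
        identity = solve-∀
        expand : + M ℤ.* ((+ (2 ℕ.* h) ℤ.+ s) ℤ.* (+ (2 ℕ.* h) ℤ.+ s))
                 ≡ + (4 ℕ.* h) ℤ.* ((+ h ℤ.+ s) ℤ.* + M) ℤ.+ + M ℤ.* (s ℤ.* s)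
        expand = ≡.trans (≡.cong (λ t → + M ℤ.* ((t ℤ.+ s) ℤ.* (t ℤ.+ s))) (ℤP.pos-* 2 h))
                 (≡.trans (identity (+ h) s (+ M))
                 (≡.cong (λ t → t ℤ.* ((+ h ℤ.+ s) ℤ.* + M) ℤ.+ + M ℤ.* (s ℤ.* s)) (≡.sym (ℤP.pos-* 4 h))))

      q≡ζ^ℤ : ∀ {n} {t : ℤ} → + n ≡ t → q n ≡ ζ^ℤ (+ M ℤ.* (t ℤ.* t))
      q≡ζ^ℤ {n} ≡.refl = ≡.cong ζ^ℤ (≡.trans (ℤP.pos-* M (n ℕ.* n)) (≡.cong (+ M ℤ.*_) (ℤP.pos-* n n)))

      q-reflect : ∀ {d h x n} .{{_ : ℕ.NonZero d}} → K ≡ 4 ℕ.* h ℕ.* d →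
                  x ≡ + h ℤ.- + n ⟨mod d ⟩ → n ℕ.≤ 2 ℕ.* h →
                  q (2 ℕ.* h ℕ.∸ n) ≈ e2πi[ x ℤ.* + M / d ] * q n
      q-reflect {d} {h} {x} {n} K≡4hd x≡h-n n≤2h = begin
        q (2 ℕ.* h ℕ.∸ n)
          ≡⟨ q≡ζ^ℤ (≡.trans (≡.sym (ℤP.⊖-≥ n≤2h)) (≡.sym (ℤP.m-n≡m⊖n (2 ℕ.* h) n))) ⟩
        ζ^ℤ (+ M ℤ.* ((+ (2 ℕ.* h) ℤ.- + n) ℤ.* (+ (2 ℕ.* h) ℤ.- + n)))
          ≈⟨ ζ^ℤ-square-shift (ℤ.- + n) K≡4hd x≡h-n ⟩
        e2πi[ x ℤ.* + M / d ] * ζ^ℤ (+ M ℤ.* (ℤ.- + n ℤ.* ℤ.- + n))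
          ≡⟨ ≡.cong (λ t → e2πi[ x ℤ.* + M / d ] * ζ^ℤ (+ M ℤ.* t)) (neg-square (+ n)) ⟩
        e2πi[ x ℤ.* + M / d ] * ζ^ℤ (+ M ℤ.* (+ n ℤ.* + n))
          ≡⟨ ≡.cong (e2πi[ x ℤ.* + M / d ] *_) (q≡ζ^ℤ {n} ≡.refl) ⟨
        e2πi[ x ℤ.* + M / d ] * q n ∎
        where
        open SetoidReasoning setoid
        neg-square : ∀ t → ℤ.- t ℤ.* ℤ.- t ≡ t ℤ.* t
        neg-square = solve-∀

      q-shift : ∀ {d h x n} .{{_ : ℕ.NonZero d}} → K ≡ 4 ℕ.* h ℕ.* d →
                x ≡ + h ℤ.+ + n ⟨mod d ⟩ → q (2 ℕ.* h ℕ.+ n) ≈ e2πi[ x ℤ.* + M / d ] * q n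
      q-shift {d} {h} {x} {n} K≡4hd x≡h+n = begin
        q (2 ℕ.* h ℕ.+ n)
          ≡⟨ q≡ζ^ℤ (ℤP.pos-+ (2 ℕ.* h) n) ⟩
        ζ^ℤ (+ M ℤ.* ((+ (2 ℕ.* h) ℤ.+ + n) ℤ.* (+ (2 ℕ.* h) ℤ.+ + n)))
          ≈⟨ ζ^ℤ-square-shift (+ n) K≡4hd x≡h+n ⟩
        e2πi[ x ℤ.* + M / d ] * ζ^ℤ (+ M ℤ.* (+ n ℤ.* + n))
          ≡⟨ ≡.cong (e2πi[ x ℤ.* + M / d ] *_) (q≡ζ^ℤ {n} ≡.refl) ⟨
        e2πi[ x ℤ.* + M / d ] * q n ∎
        where open SetoidReasoning setoid

      module ResidueClasses (D : ℕ) .{{_ : ℕ.NonZero D}} where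

        t : ℕ → ℕ → Carrier
        t r n = select ((+ n) mod D ℕ.≟ r) (q n)

        t-off-class : ∀ {r n} → ¬ (+ n ≡ + r ⟨mod D ⟩) → t r n ≈ 0#
        t-off-class {r} {n} n≢r = select-no ((+ n) mod D ℕ.≟ r) (λ e → n≢r (mod≡⇒⟨mod⟩ e))

        module Symmetry (d h : ℕ) .{{_ : ℕ.NonZero d}} (K≡4hd : K ≡ 4 ℕ.* h ℕ.* d) (d∣D : d ℕD.∣ D) where

          t-reflect : ∀ {x r r′ n} → x ≡ + h ℤ.- + r′ ⟨mod d ⟩ →
                      + r ℤ.+ + r′ ≡ + (2 ℕ.* h) ⟨mod D ⟩ →
                      r ℕ.< D → r′ ℕ.< D → n ℕ.≤ 2 ℕ.* h →
                      t r (2 ℕ.* h ℕ.∸ n) ≈ e2πi[ x ℤ.* + M / d ] * t r′ n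
          t-reflect {x} {r} {r′} {n} x≡h-r′ r+r′≡2h r<D r′<D n≤2h =
            select-transfer ((+ (2h ℕ.∸ n)) mod D ℕ.≟ r) ((+ n) mod D ℕ.≟ r′)
              (λ e → ⟨mod⟩⇒mod≡ r′<D (n≡r′ (mod≡⇒⟨mod⟩ e)))
              (λ e → ⟨mod⟩⇒mod≡ r<D (2h∸n≡r (mod≡⇒⟨mod⟩ e)))
              (λ e → q-reflect K≡4hd (x≡h-n (mod≡⇒⟨mod⟩ e)) n≤2h)
            where
            2h : ℕ
            2h = 2 ℕ.* h
            2h-n≡2h∸n : + 2h ℤ.- + n ≡ + (2h ℕ.∸ n)
            2h-n≡2h∸n = ≡.trans (ℤP.m-n≡m⊖n 2h n) (ℤP.⊖-≥ n≤2h)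
            2h-[2h∸n]≡n : + 2h ℤ.- + (2h ℕ.∸ n) ≡ + n
            2h-[2h∸n]≡n = ≡.trans (≡.cong (ℤ._-_ (+ 2h)) (≡.sym 2h-n≡2h∸n)) (a-[a-b]≡b (+ 2h) (+ n))
              where
              a-[a-b]≡b : ∀ a b → a ℤ.- (a ℤ.- b) ≡ b
              a-[a-b]≡b = solve-∀
            n≡r′ : + (2h ℕ.∸ n) ≡ + r ⟨mod D ⟩ → + n ≡ + r′ ⟨mod D ⟩
            n≡r′ 2h∸n≡r =
              ≡.subst (_≡ + r′ ⟨mod D ⟩) 2h-[2h∸n]≡n (⟨mod⟩-complement r+r′≡2h 2h∸n≡r)
            2h∸n≡r : + n ≡ + r′ ⟨mod D ⟩ → + (2h ℕ.∸ n) ≡ + r ⟨mod D ⟩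
            2h∸n≡r n≡r′ = ≡.subst (_≡ + r ⟨mod D ⟩) 2h-n≡2h∸n
              (⟨mod⟩-complement (⟨mod⟩-trans (⟨mod⟩-reflexive (ℤP.+-comm (+ r′) (+ r))) r+r′≡2h) n≡r′)
            x≡h-n : + n ≡ + r′ ⟨mod D ⟩ → x ≡ + h ℤ.- + n ⟨mod d ⟩
            x≡h-n n≡r′ =
              ⟨mod⟩-trans x≡h-r′ (⟨mod⟩-∣ d∣D (⟨mod⟩-− (⟨mod⟩-refl {+ h}) (⟨mod⟩-sym n≡r′)))

          t-shift : ∀ {x r r′ n} → x ≡ + h ℤ.+ + r′ ⟨mod d ⟩ →
                    + r ≡ + (2 ℕ.* h) ℤ.+ + r′ ⟨mod D ⟩ →
                    r ℕ.< D → r′ ℕ.< D → t r (2 ℕ.* h ℕ.+ n) ≈ e2πi[ x ℤ.* + M / d ] * t r′ n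
          t-shift {x} {r} {r′} {n} x≡h+r′ r≡2h+r′ r<D r′<D =
            select-transfer ((+ (2h ℕ.+ n)) mod D ℕ.≟ r) ((+ n) mod D ℕ.≟ r′)
              (λ e → ⟨mod⟩⇒mod≡ r′<D (n≡r′ (mod≡⇒⟨mod⟩ e)))
              (λ e → ⟨mod⟩⇒mod≡ r<D (2h+n≡r (mod≡⇒⟨mod⟩ e)))
              (λ e → q-shift {h = h} {n = n} K≡4hd (x≡h+n (mod≡⇒⟨mod⟩ e)))
            where
            2h : ℕ
            2h = 2 ℕ.* h
            n≡r′ : + (2h ℕ.+ n) ≡ + r ⟨mod D ⟩ → + n ≡ + r′ ⟨mod D ⟩
            n≡r′ 2h+n≡r = ⟨mod⟩-+-cancelˡ {+ 2h}
              (≡.subst (_≡ + 2h ℤ.+ + r′ ⟨mod D ⟩) (ℤP.pos-+ 2h n) (⟨mod⟩-trans 2h+n≡r r≡2h+r′))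
            2h+n≡r : + n ≡ + r′ ⟨mod D ⟩ → + (2h ℕ.+ n) ≡ + r ⟨mod D ⟩
            2h+n≡r n≡r′ = ≡.subst (_≡ + r ⟨mod D ⟩) (≡.sym (ℤP.pos-+ 2h n))
              (⟨mod⟩-trans (⟨mod⟩-+ (⟨mod⟩-refl {+ 2h}) n≡r′) (⟨mod⟩-sym r≡2h+r′))
            x≡h+n : + n ≡ + r′ ⟨mod D ⟩ → x ≡ + h ℤ.+ + n ⟨mod d ⟩
            x≡h+n n≡r′ =
              ⟨mod⟩-trans x≡h+r′ (⟨mod⟩-∣ d∣D (⟨mod⟩-+ (⟨mod⟩-refl {+ h}) (⟨mod⟩-sym n≡r′)))

          ∑-reflect-t : ∀ lo lo′ L {A x r r′} → A ≡ 2 ℕ.* h → lo ℕ.+ lo′ ℕ.+ L ≡ suc A →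
                        x ≡ + h ℤ.- + r′ ⟨mod d ⟩ → + r ℤ.+ + r′ ≡ + A ⟨mod D ⟩ →
                        r ℕ.< D → r′ ℕ.< D →
                        ∑[ j < L ] t r (lo ℕ.+ toℕ j)
                          ≈ e2πi[ x ℤ.* + M / d ] * ∑[ j < L ] t r′ (lo′ ℕ.+ toℕ j)
          ∑-reflect-t lo lo′ L {x = x} {r} {r′} ≡.refl window x≡h-r′ r+r′≡2h r<D r′<D = begin
            ∑[ j < L ] t r (lo ℕ.+ toℕ j)
              ≈⟨ ∑-reflect {lo} {lo′} {L} (t r) window ⟩
            ∑[ j < L ] t r (2 ℕ.* h ℕ.∸ (lo′ ℕ.+ toℕ j))
              ≈⟨ sum-cong-≋ {L} (λ j → t-reflect x≡h-r′ r+r′≡2h r<D r′<D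
                                                  (reflect-bound {lo} window (toℕ<n j))) ⟩
            ∑[ j < L ] (e2πi[ x ℤ.* + M / d ] * t r′ (lo′ ℕ.+ toℕ j))
              ≈⟨ *-distribˡ-sum {L} e2πi[ x ℤ.* + M / d ] (λ j → t r′ (lo′ ℕ.+ toℕ j)) ⟨
            e2πi[ x ℤ.* + M / d ] * ∑[ j < L ] t r′ (lo′ ℕ.+ toℕ j) ∎
            where open SetoidReasoning setoid

          ∑-shift-t : ∀ lo lo′ L {A x r r′} → A ≡ 2 ℕ.* h → lo ≡ A ℕ.+ lo′ →
                      x ≡ + h ℤ.+ + r′ ⟨mod d ⟩ → + r ≡ + A ℤ.+ + r′ ⟨mod D ⟩ →
                      r ℕ.< D → r′ ℕ.< D →
                      ∑[ j < L ] t r (lo ℕ.+ toℕ j)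
                        ≈ e2πi[ x ℤ.* + M / d ] * ∑[ j < L ] t r′ (lo′ ℕ.+ toℕ j)
          ∑-shift-t lo lo′ L {x = x} {r} {r′} ≡.refl ≡.refl x≡h+r′ r≡2h+r′ r<D r′<D = begin
            ∑[ j < L ] t r (2 ℕ.* h ℕ.+ lo′ ℕ.+ toℕ j)
              ≡⟨ sum-cong-≗ {L} (λ j → ≡.cong (t r) (ℕP.+-assoc (2 ℕ.* h) lo′ (toℕ j))) ⟩
            ∑[ j < L ] t r (2 ℕ.* h ℕ.+ (lo′ ℕ.+ toℕ j))
              ≈⟨ sum-cong-≋ {L} (λ j → t-shift {n = lo′ ℕ.+ toℕ j} x≡h+r′ r≡2h+r′ r<D r′<D) ⟩
            ∑[ j < L ] (e2πi[ x ℤ.* + M / d ] * t r′ (lo′ ℕ.+ toℕ j))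
              ≈⟨ *-distribˡ-sum {L} e2πi[ x ℤ.* + M / d ] (λ j → t r′ (lo′ ℕ.+ toℕ j)) ⟨
            e2πi[ x ℤ.* + M / d ] * ∑[ j < L ] t r′ (lo′ ℕ.+ toℕ j) ∎
            where open SetoidReasoning setoid

module Parts {c ℓ : Level} (p₃ ℓ₃ M N : ℕ) .{{_ : ℕ.NonZero p₃}} .{{_ : ℕ.NonZero N}}
             (6⊥p₃ : Coprime 6 p₃) (0<ℓ₃ : 0 ℕ.< ℓ₃) (ℓ₃<p₃ : ℓ₃ ℕ.< p₃)
             (R : CommutativeRing c ℓ) (ζ : CommutativeRing.Carrier R)
             (ζ-primitive : RootsOfUnity.IsPrimitiveRootOfUnity R ζ (Kord p₃ N)) where
  open CommutativeRing R
  open Sums R ζ p₃ ℓ₃ M N using (T; S; qpow; e2πi[_/_])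
  open Residues p₃ ℓ₃
  open FiniteSums R
  open import Algebra.Properties.Semiring.Sum semiring using (sum-syntax; sum-cong-≗)
  open SetoidReasoning setoid
  open import Data.Nat.Tactic.RingSolver using () renaming (solve-∀ to ℕ-solve-∀)
  open import Data.Integer.Tactic.RingSolver using (solve-∀)

  instance
    K≢0 : ℕ.NonZero (Kord p₃ N)
    K≢0 = ℕP.m*n≢0 (4 ℕ.* P p₃) N {{ℕP.m*n≢0 4 (P p₃) {{_}} {{ℕP.m*n≢0 6 p₃}}}}

  open RootOfUnity R ζ (Kord p₃ N)
  open Periodic (proj₁ ζ-primitive)
  open Quadratic M
  open ResidueClasses D

  C : ℕ
  C = 2 ℕ.* p₃ ℕ.* N

  T≈∑ : ∀ ε → T ε ≈ ∑[ j < suc C ] t (m p₃ ℓ₃ ε) (toℕ j)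
  T≈∑ ε = ΣRange≈∑ {ζ} {Kord p₃ N} 0 C D (m p₃ ℓ₃ ε) qpow (suc C) ≡.refl

  S≈∑ : ∀ ε → S ε ≈ ∑[ j < C ] t (m p₃ ℓ₃ ε) (suc C ℕ.+ toℕ j)
  S≈∑ ε = ΣRange≈∑ {ζ} {Kord p₃ N} (suc C) (4 ℕ.* p₃ ℕ.* N) D (m p₃ ℓ₃ ε) qpow C
                   (≡.cong suc (identity p₃ N))
    where
    identity : ∀ p n → 4 ℕ.* p ℕ.* n ≡ 2 ℕ.* p ℕ.* n ℕ.+ 2 ℕ.* p ℕ.* n
    identity = ℕ-solve-∀

  t-vanishes : ∀ ε {n} w → n ≡ p₃ ℕ.* w → t (m p₃ ℓ₃ ε) n ≈ 0#
  t-vanishes ε w ≡.refl = t-off-class (m≢multiple-of-p₃ 6⊥p₃ 0<ℓ₃ ℓ₃<p₃ ε w)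

  p₃*s≡cp₃N : ∀ {s} c → s ≡ + c ℤ.* + N ⟨mod 12 ⟩ → + p₃ ℤ.* s ≡ + (c ℕ.* p₃ ℕ.* N) ⟨mod D ⟩
  p₃*s≡cp₃N {s} c s≡cN = ⟨mod⟩-trans (scale-to-D s≡cN) (⟨mod⟩-reflexive cast)
    where
    reorder : ∀ p c n → p ℤ.* (c ℤ.* n) ≡ c ℤ.* p ℤ.* n
    reorder = solve-∀
    cast : + p₃ ℤ.* (+ c ℤ.* + N) ≡ + (c ℕ.* p₃ ℕ.* N)
    cast = ≡.trans (reorder (+ p₃) (+ c) (+ N))
           (≡.sym (≡.trans (ℤP.pos-* (c ℕ.* p₃) N) (≡.cong (ℤ._* + N) (ℤP.pos-* c p₃))))

  D≡6*2p₃ : D ≡ 6 ℕ.* (2 ℕ.* p₃)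
  D≡6*2p₃ = identity p₃
    where
    identity : ∀ p → 2 ℕ.* (6 ℕ.* p) ≡ 6 ℕ.* (2 ℕ.* p)
    identity = ℕ-solve-∀

  6∣D : 6 ℕD.∣ D
  6∣D = ℕD.∣n⇒∣m*n 2 (ℕD.m∣m*n p₃)

  K≡4[p₃N]6 : Kord p₃ N ≡ 4 ℕ.* (p₃ ℕ.* N) ℕ.* 6
  K≡4[p₃N]6 = identity p₃ N
    where
    identity : ∀ p n → 4 ℕ.* (6 ℕ.* p) ℕ.* n ≡ 4 ℕ.* (p ℕ.* n) ℕ.* 6
    identity = ℕ-solve-∀

  6N+8N≡2N : + 6 ℤ.* + N ℤ.+ + 8 ℤ.* + N ≡ + 2 ℤ.* + N ⟨mod 12 ⟩
  6N+8N≡2N = ⟨mod⟩-intro (+ N) (identity (+ N))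
    where
    identity : ∀ n → + 6 ℤ.* n ℤ.+ + 8 ℤ.* n ℤ.- + 2 ℤ.* n ≡ n ℤ.* + 12
    identity = solve-∀

  module _ (ε ε′ : Triple) where
    r r′ : ℕ
    r = m p₃ ℓ₃ ε
    r′ = m p₃ ℓ₃ ε′

    part-i : half (ε₁ ε ℤ.+ ε₁ ε′) ≡ + N [mod 2 ] → ε₂ ε ℤ.+ ε₂ ε′ ≡ + N [mod 3 ] →
             ε₃ ε′ ≡ ℤ.- ε₃ ε →
             ((+ r ℤ.+ + r′) ÷ (2 ℕ.* P p₃)) ≡ ((+ N) ÷ 6) [mod1] ×
             T ε ≈ e2πi[ (+ (p₃ ℕ.* N) ℤ.- + r′) ℤ.* + M / 6 ] * T ε′
    part-i h₁ h₂ h₃ = ⟨mod⟩⇒÷≡[mod1] D 6 (2 ℕ.* p₃) D≡6*2p₃ r+r′≡C , (begin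
      T ε                               ≈⟨ T≈∑ ε ⟩
      ∑[ j < suc C ] t r (toℕ j)        ≈⟨ ∑-reflect-t 0 0 (suc C) (ℕP.*-assoc 2 p₃ N) ≡.refl
                                                       ⟨mod⟩-refl r+r′≡C (m<D ε) (m<D ε′) ⟩
      ω * ∑[ j < suc C ] t r′ (toℕ j)   ≈⟨ *-congˡ (T≈∑ ε′) ⟨
      ω * T ε′                          ∎)
      where
      open Symmetry 6 (p₃ ℕ.* N) K≡4[p₃N]6 6∣D
      ω : Carrier
      ω = e2πi[ (+ (p₃ ℕ.* N) ℤ.- + r′) ℤ.* + M / 6 ]
      r+r′≡C : + r ℤ.+ + r′ ≡ + C ⟨mod D ⟩
      r+r′≡C = ⟨mod⟩-trans (m+m′≡p₃[6a+8b] ε ε′ (+ N) (+ N) h₁ h₂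
                              (≡.trans (≡.cong (ℤ._+_ (ε₃ ε)) h₃) (ℤP.+-inverseʳ (ε₃ ε))))
                           (p₃*s≡cp₃N 2 6N+8N≡2N)

    part-ii : half (ε₁ ε ℤ.- ε₁ ε′) ≡ + N [mod 2 ] → ε₂ ε ℤ.- ε₂ ε′ ≡ + N [mod 3 ] →
              ε₃ ε′ ≡ ε₃ ε →
              ((+ r ℤ.- + r′) ÷ (2 ℕ.* P p₃)) ≡ ((+ N) ÷ 6) [mod1] ×
              S ε ≈ e2πi[ (+ (p₃ ℕ.* N) ℤ.+ + r′) ℤ.* + M / 6 ] * T ε′
    part-ii h₁ h₂ h₃ = ⟨mod⟩⇒÷≡[mod1] D 6 (2 ℕ.* p₃) D≡6*2p₃ r-r′≡C , (begin
      S ε                                   ≈⟨ S≈∑ ε ⟩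
      ∑[ j < C ] t r (suc C ℕ.+ toℕ j)      ≈⟨ ∑-shift-t (suc C) 1 C (ℕP.*-assoc 2 p₃ N) (ℕP.+-comm 1 C)
                                                         ⟨mod⟩-refl r≡C+r′ (m<D ε) (m<D ε′) ⟩
      ω * ∑[ j < C ] t r′ (suc (toℕ j))
        ≈⟨ *-congˡ (∑-drop-first C (t r′) (t-vanishes ε′ 0 0≡p₃*0)) ⟨
      ω * ∑[ j < suc C ] t r′ (toℕ j)       ≈⟨ *-congˡ (T≈∑ ε′) ⟨
      ω * T ε′                              ∎)
      where
      open Symmetry 6 (p₃ ℕ.* N) K≡4[p₃N]6 6∣D
      ω : Carrier
      ω = e2πi[ (+ (p₃ ℕ.* N) ℤ.+ + r′) ℤ.* + M / 6 ]
      0≡p₃*0 : 0 ≡ p₃ ℕ.* 0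
      0≡p₃*0 = ≡.sym (ℕP.*-zeroʳ p₃)
      r-r′≡C : + r ℤ.- + r′ ≡ + C ⟨mod D ⟩
      r-r′≡C = ⟨mod⟩-trans (m-m′≡p₃[6a+8b] ε ε′ (+ N) (+ N) h₁ h₂
                              (≡.trans (≡.cong (ℤ._-_ (ε₃ ε)) h₃) (ℤP.+-inverseʳ (ε₃ ε))))
                           (p₃*s≡cp₃N 2 6N+8N≡2N)
      r≡C+r′ : + r ≡ + C ℤ.+ + r′ ⟨mod D ⟩
      r≡C+r′ = ⟨mod⟩-trans (⟨mod⟩-reflexive (split (+ r) (+ r′)))
                           (⟨mod⟩-+ r-r′≡C (⟨mod⟩-refl {+ r′}))
        where
        split : ∀ a b → a ≡ (a ℤ.- b) ℤ.+ b
        split = solve-∀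

    part-iii : half (ε₁ ε ℤ.+ ε₁ ε′) ≡ + 0 [mod 2 ] → ε₂ ε ℤ.+ ε₂ ε′ ≡ + (2 ℕ.* N) [mod 3 ] →
               ε₃ ε ≡ ℤ.- ε₃ ε′ →
               ((+ r ℤ.+ + r′) ÷ (2 ℕ.* P p₃)) ≡ ((+ N) ÷ 3) [mod1] ×
               S ε ≈ e2πi[ (+ 2 ℤ.* + (p₃ ℕ.* N) ℤ.- + r′) ℤ.* + M / 3 ] * T ε′
    part-iii h₁ h₂ h₃ = ⟨mod⟩⇒÷≡[mod1] D 3 (4 ℕ.* p₃) (D≡3*4p p₃) r+r′≡2C , (begin
      S ε                                   ≈⟨ S≈∑ ε ⟩
      ∑[ j < C ] t r (suc C ℕ.+ toℕ j)      ≈⟨ ∑-reflect-t (suc C) 0 C (2C≡2h p₃ N) (≡.cong suc (window p₃ N))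
                                                           x≡h-r′ r+r′≡2C (m<D ε) (m<D ε′) ⟩
      ω * ∑[ j < C ] t r′ (toℕ j)
        ≈⟨ *-congˡ (∑-drop-last C (t r′) (t-vanishes ε′ (2 ℕ.* N) (C≡p*2n p₃ N))) ⟨
      ω * ∑[ j < suc C ] t r′ (toℕ j)       ≈⟨ *-congˡ (T≈∑ ε′) ⟨
      ω * T ε′                              ∎)
      where
      D≡3*4p : ∀ p → 2 ℕ.* (6 ℕ.* p) ≡ 3 ℕ.* (4 ℕ.* p)
      D≡3*4p = ℕ-solve-∀
      K≡4hd : ∀ p n → 4 ℕ.* (6 ℕ.* p) ℕ.* n ≡ 4 ℕ.* (2 ℕ.* (p ℕ.* n)) ℕ.* 3
      K≡4hd = ℕ-solve-∀
      2C≡2h : ∀ p n → 4 ℕ.* p ℕ.* n ≡ 2 ℕ.* (2 ℕ.* (p ℕ.* n))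
      2C≡2h = ℕ-solve-∀
      window : ∀ p n → 2 ℕ.* p ℕ.* n ℕ.+ 0 ℕ.+ 2 ℕ.* p ℕ.* n ≡ 4 ℕ.* p ℕ.* n
      window = ℕ-solve-∀
      C≡p*2n : ∀ p n → 2 ℕ.* p ℕ.* n ≡ p ℕ.* (2 ℕ.* n)
      C≡p*2n = ℕ-solve-∀
      open Symmetry 3 (2 ℕ.* (p₃ ℕ.* N)) (K≡4hd p₃ N) (ℕD.∣-trans (ℕD.divides 2 ≡.refl) 6∣D)
      ω : Carrier
      ω = e2πi[ (+ 2 ℤ.* + (p₃ ℕ.* N) ℤ.- + r′) ℤ.* + M / 3 ]
      x≡h-r′ : + 2 ℤ.* + (p₃ ℕ.* N) ℤ.- + r′ ≡ + (2 ℕ.* (p₃ ℕ.* N)) ℤ.- + r′ ⟨mod 3 ⟩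
      x≡h-r′ = ⟨mod⟩-reflexive (≡.cong (ℤ._- + r′) (≡.sym (ℤP.pos-* 2 (p₃ ℕ.* N))))
      6·0+8·2N≡4N : + 6 ℤ.* + 0 ℤ.+ + 8 ℤ.* + (2 ℕ.* N) ≡ + 4 ℤ.* + N ⟨mod 12 ⟩
      6·0+8·2N≡4N = ⟨mod⟩-intro (+ N)
        (≡.trans (≡.cong (λ b → + 6 ℤ.* + 0 ℤ.+ + 8 ℤ.* b ℤ.- + 4 ℤ.* + N) (ℤP.pos-* 2 N)) (identity (+ N)))
        where
        identity : ∀ n → + 6 ℤ.* + 0 ℤ.+ + 8 ℤ.* (+ 2 ℤ.* n) ℤ.- + 4 ℤ.* n ≡ n ℤ.* + 12
        identity = solve-∀
      r+r′≡2C : + r ℤ.+ + r′ ≡ + (4 ℕ.* p₃ ℕ.* N) ⟨mod D ⟩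
      r+r′≡2C = ⟨mod⟩-trans (m+m′≡p₃[6a+8b] ε ε′ (+ 0) (+ (2 ℕ.* N)) h₁ h₂
                               (≡.trans (≡.cong (ℤ._+ ε₃ ε′) h₃) (ℤP.+-inverseˡ (ε₃ ε′))))
                            (p₃*s≡cp₃N 4 6·0+8·2N≡4N)

    part-iv : half (ε₁ ε ℤ.+ ε₁ ε′) ≡ + N [mod 2 ] → ε₂ ε ℤ.+ ε₂ ε′ ≡ + 0 [mod 3 ] →
              ε₃ ε ≡ ℤ.- ε₃ ε′ →
              ((+ r ℤ.+ + r′) ÷ (2 ℕ.* P p₃)) ≡ ((+ N) ÷ 2) [mod1] ×
              S ε ≈ e2πi[ (+ (p₃ ℕ.* N) ℤ.- + r′) ℤ.* + M / 2 ] * S ε′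
    part-iv h₁ h₂ h₃ = ⟨mod⟩⇒÷≡[mod1] D 2 (6 ℕ.* p₃) ≡.refl r+r′≡3C , (begin
      S ε                                   ≈⟨ S≈∑ ε ⟩
      ∑[ j < C ] t r (suc C ℕ.+ toℕ j)      ≈⟨ ∑-reflect-t (suc C) C C (3C≡2h p₃ N) (≡.cong suc (window p₃ N))
                                                           x≡h-r′ r+r′≡3C (m<D ε) (m<D ε′) ⟩
      ω * ∑[ j < C ] g (toℕ j)
        ≈⟨ *-congˡ (∑-drop-last C g (t-vanishes ε′ (4 ℕ.* N) (C+C≡p*4n p₃ N))) ⟨
      ω * ∑[ j < suc C ] g (toℕ j)
        ≈⟨ *-congˡ (∑-drop-first C g (t-vanishes ε′ (2 ℕ.* N) (C+0≡p*2n p₃ N))) ⟩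
      ω * ∑[ j < C ] g (suc (toℕ j))
        ≡⟨ ≡.cong (ω *_) (sum-cong-≗ {C} (λ j → ≡.cong (t r′) (ℕP.+-suc C (toℕ j)))) ⟩
      ω * ∑[ j < C ] t r′ (suc C ℕ.+ toℕ j) ≈⟨ *-congˡ (S≈∑ ε′) ⟨
      ω * S ε′                              ∎)
      where
      K≡4hd : ∀ p n → 4 ℕ.* (6 ℕ.* p) ℕ.* n ≡ 4 ℕ.* (3 ℕ.* (p ℕ.* n)) ℕ.* 2
      K≡4hd = ℕ-solve-∀
      3C≡2h : ∀ p n → 6 ℕ.* p ℕ.* n ≡ 2 ℕ.* (3 ℕ.* (p ℕ.* n))
      3C≡2h = ℕ-solve-∀
      window : ∀ p n → 2 ℕ.* p ℕ.* n ℕ.+ 2 ℕ.* p ℕ.* n ℕ.+ 2 ℕ.* p ℕ.* n ≡ 6 ℕ.* p ℕ.* n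
      window = ℕ-solve-∀
      C+C≡p*4n : ∀ p n → 2 ℕ.* p ℕ.* n ℕ.+ 2 ℕ.* p ℕ.* n ≡ p ℕ.* (4 ℕ.* n)
      C+C≡p*4n = ℕ-solve-∀
      C+0≡p*2n : ∀ p n → 2 ℕ.* p ℕ.* n ℕ.+ 0 ≡ p ℕ.* (2 ℕ.* n)
      C+0≡p*2n = ℕ-solve-∀
      open Symmetry 2 (3 ℕ.* (p₃ ℕ.* N)) (K≡4hd p₃ N) (ℕD.m∣m*n (6 ℕ.* p₃))
      ω : Carrier
      ω = e2πi[ (+ (p₃ ℕ.* N) ℤ.- + r′) ℤ.* + M / 2 ]
      g : ℕ → Carrier
      g k = t r′ (C ℕ.+ k)
      x≡h-r′ : + (p₃ ℕ.* N) ℤ.- + r′ ≡ + (3 ℕ.* (p₃ ℕ.* N)) ℤ.- + r′ ⟨mod 2 ⟩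
      x≡h-r′ = ⟨mod⟩-trans (⟨mod⟩-intro (ℤ.- + (p₃ ℕ.* N)) (differ (+ (p₃ ℕ.* N)) (+ r′)))
                          (⟨mod⟩-reflexive (≡.cong (ℤ._- + r′) (≡.sym (ℤP.pos-* 3 (p₃ ℕ.* N)))))
        where
        differ : ∀ a b → a ℤ.- b ℤ.- (+ 3 ℤ.* a ℤ.- b) ≡ ℤ.- a ℤ.* + 2
        differ = solve-∀
      6N+8·0≡6N : + 6 ℤ.* + N ℤ.+ + 8 ℤ.* + 0 ≡ + 6 ℤ.* + N ⟨mod 12 ⟩
      6N+8·0≡6N = ⟨mod⟩-reflexive (identity (+ N))
        where
        identity : ∀ n → + 6 ℤ.* n ℤ.+ + 8 ℤ.* + 0 ≡ + 6 ℤ.* n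
        identity = solve-∀
      r+r′≡3C : + r ℤ.+ + r′ ≡ + (6 ℕ.* p₃ ℕ.* N) ⟨mod D ⟩
      r+r′≡3C = ⟨mod⟩-trans (m+m′≡p₃[6a+8b] ε ε′ (+ N) (+ 0) h₁ h₂
                               (≡.trans (≡.cong (ℤ._+ ε₃ ε′) h₃) (ℤP.+-inverseˡ (ε₃ ε′))))
                            (p₃*s≡cp₃N 6 6N+8·0≡6N)

proposition3p4 :
  ∀ {c ℓ : Level} (p₃ ℓ₃ M N : ℕ) →
  0 ℕ.< p₃ → Coprime 6 p₃ →
  0 ℕ.< ℓ₃ → ℓ₃ ℕ.< p₃ →
  0 ℕ.< M → 0 ℕ.< N → Coprime M N →
  (R : CommutativeRing c ℓ) (ζ : CommutativeRing.Carrier R) →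
  RootsOfUnity.IsPrimitiveRootOfUnity R ζ (Kord p₃ N) →
  (ε ε′ : Triple) →
  let open CommutativeRing R
      open Sums R ζ p₃ ℓ₃ M N
      mε = + (m p₃ ℓ₃ ε)
      mε′ = + (m p₃ ℓ₃ ε′)
      2P = 2 ℕ.* P p₃
      p₃N = + (p₃ ℕ.* N)
  in
  -- (i)
  ( half (ε₁ ε ℤ.+ ε₁ ε′) ≡ + N [mod 2 ] →
    ε₂ ε ℤ.+ ε₂ ε′ ≡ + N [mod 3 ] →
    ε₃ ε′ ≡ ℤ.- ε₃ ε →
    ((mε ℤ.+ mε′) ÷ 2P) ≡ ((+ N) ÷ 6) [mod1] ×
    T ε ≈ e2πi[ (p₃N ℤ.- mε′) ℤ.* + M / 6 ] * T ε′ ) ×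
  -- (ii)
  ( half (ε₁ ε ℤ.- ε₁ ε′) ≡ + N [mod 2 ] →
    ε₂ ε ℤ.- ε₂ ε′ ≡ + N [mod 3 ] →
    ε₃ ε′ ≡ ε₃ ε →
    ((mε ℤ.- mε′) ÷ 2P) ≡ ((+ N) ÷ 6) [mod1] ×
    S ε ≈ e2πi[ (p₃N ℤ.+ mε′) ℤ.* + M / 6 ] * T ε′ ) ×
  -- (iii)
  ( half (ε₁ ε ℤ.+ ε₁ ε′) ≡ + 0 [mod 2 ] →
    ε₂ ε ℤ.+ ε₂ ε′ ≡ + (2 ℕ.* N) [mod 3 ] →
    ε₃ ε ≡ ℤ.- ε₃ ε′ →
    ((mε ℤ.+ mε′) ÷ 2P) ≡ ((+ N) ÷ 3) [mod1] ×
    S ε ≈ e2πi[ (+ 2 ℤ.* p₃N ℤ.- mε′) ℤ.* + M / 3 ] * T ε′ ) ×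
  -- (iv)
  ( half (ε₁ ε ℤ.+ ε₁ ε′) ≡ + N [mod 2 ] →
    ε₂ ε ℤ.+ ε₂ ε′ ≡ + 0 [mod 3 ] →
    ε₃ ε ≡ ℤ.- ε₃ ε′ →
    ((mε ℤ.+ mε′) ÷ 2P) ≡ ((+ N) ÷ 2) [mod1] ×
    S ε ≈ e2πi[ (p₃N ℤ.- mε′) ℤ.* + M / 2 ] * S ε′ )
proposition3p4 p₃ ℓ₃ M N 0<p₃ 6⊥p₃ 0<ℓ₃ ℓ₃<p₃ _ 0<N _ R ζ ζ-primitive ε ε′ =
  part-i ε ε′ , part-ii ε ε′ , part-iii ε ε′ , part-iv ε ε′
  where
  open Parts p₃ ℓ₃ M N {{ℕ.>-nonZero 0<p₃}} {{ℕ.>-nonZero 0<N}} 6⊥p₃ 0<ℓ₃ ℓ₃<p₃ R ζ ζ-primitive
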